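{- Let $h$ be a fixed integer, let $G$ be an $n$-vertex graph (undirected or directed) and let $x$ be the number of vertices of $G$ participating in at least one $h$-cycle. Sample a uniformly random coloring $\varphi:V(G)\to[h]$, let $V_i=\varphi^{ -1}(i)$, and sample $U_1\subseteq V_1$ by including each vertex of $V_1$ independently with probability $p\in[0,1]$. Let $F$ be the subgraph of $G_\varphi$ induced by $U_1\cup V_2\cup\dots\cup V_h$. If $p\ge 4h^h/x$, then $F$ contains an $h$-cycle with probability at least $\frac{1}{4h^h}$.
   Context: For a coloring $\varphi:V\to[h]$, $G_\varphi$ is the directed graph on $V(G)$ whose edges are the pairs $(u,v)$ such that $uv$ is an edge of $G$ (the directed edge $(u,v)$ if $G$ is directed) and $\varphi(v)\equiv\varphi(u)+1 \pmod h$, i.e. edges go from color class $i$ to color class $i+1$ for $i<h$ and from class $h$ to class $1$. An $h$-cycle in the directed graph $F$ is a directed cycle on $h$ distinct vertices.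
   Formalization: The inclusion probability $p$ takes only rational values in [0,1]. -}

module Defs where

open import Data.Nat as ℕ using (ℕ; zero; suc; NonZero; _^_)
open import Data.Nat.DivMod using (_%_; m%n<n)
open import Data.Nat.Properties using (m^n≢0)
open import Data.Integer using (+_)
open import Data.Fin using (Fin; toℕ; fromℕ<)
open import Data.Fin.Properties using (any?; all?) renaming (_≟_ to _≟ᶠ_)
open import Data.Vec using (Vec; []; _∷_; lookup)
open import Data.List using (List; []; _∷_; length; filter; allFin; map; concatMap; foldr)
open import Data.Bool using (Bool; true; false; if_then_else_; T; T?)
open import Data.Product using (Σ; ∃; _×_; _,_)
open import Data.Sum using (_⊎_)
open import Relation.Nullary using (Dec; yes; no; ¬_; does)
open import Relation.Nullary.Decidable using (map′; _×-dec_; _→-dec_; _⊎-dec_; ¬?)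
open import Relation.Binary.PropositionalEquality using (_≡_)
open import Data.Rational using (ℚ; 0ℚ; 1ℚ; _+_; _*_; _-_; _/_)

-- Directed graphs on vertex set Fin n (an undirected graph is the
-- symmetric digraph: uv ∈ E gives both (u,v) and (v,u)).

Digraph : ℕ → Set
Digraph n = Fin n → Fin n → Bool

next : ∀ {h} .{{_ : NonZero h}} → Fin h → Fin h
next {h} i = fromℕ< (m%n<n (suc (toℕ i)) h)

IsCycle : ∀ {n} h .{{_ : NonZero h}} → (Fin n → Fin n → Set) → Vec (Fin n) h → Set
IsCycle h R c =
  (∀ i j → lookup c i ≡ lookup c j → i ≡ j) × (∀ i → R (lookup c i) (lookup c (next i)))

HasCycle : ∀ {n} h .{{_ : NonZero h}} → (Fin n → Fin n → Set) → Set
HasCycle {n} h R = Σ (Vec (Fin n) h) (IsCycle h R)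

OnCycle : ∀ {n} h .{{_ : NonZero h}} → (Fin n → Fin n → Set) → Fin n → Set
OnCycle {n} h R v = Σ (Vec (Fin n) h) λ c → IsCycle h R c × ∃ λ i → lookup c i ≡ v

vec-any? : ∀ {n} k {P : Vec (Fin n) k → Set} → (∀ v → Dec (P v)) → Dec (Σ (Vec (Fin n) k) P)
vec-any? zero P? with P? []
... | yes p = yes ([] , p)
... | no ¬p = no λ { ([] , p) → ¬p p }
vec-any? (suc k) {P} P? =
  map′ (λ { (a , v , p) → (a ∷ v , p) }) (λ { (a ∷ v , p) → (a , v , p) })
       (any? (λ a → vec-any? k (λ v → P? (a ∷ v))))

IsCycle? : ∀ {n} h .{{_ : NonZero h}} {R : Fin n → Fin n → Set} →
           (∀ u v → Dec (R u v)) → ∀ c → Dec (IsCycle h R c)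
IsCycle? h R? c =
  all? (λ i → all? (λ j → (lookup c i ≟ᶠ lookup c j) →-dec (i ≟ᶠ j)))
  ×-dec all? (λ i → R? (lookup c i) (lookup c (next i)))

HasCycle? : ∀ {n} h .{{_ : NonZero h}} {R : Fin n → Fin n → Set} →
            (∀ u v → Dec (R u v)) → Dec (HasCycle h R)
HasCycle? h R? = vec-any? h (IsCycle? h R?)

OnCycle? : ∀ {n} h .{{_ : NonZero h}} {R : Fin n → Fin n → Set} →
           (∀ u v → Dec (R u v)) → ∀ v → Dec (OnCycle h R v)
OnCycle? h R? v = vec-any? h λ c → IsCycle? h R? c ×-dec any? (λ i → lookup c i ≟ᶠ v)

Edge : ∀ {n} → Digraph n → Fin n → Fin n → Set
Edge E u v = T (E u v)

x : ∀ {n} h .{{_ : NonZero h}} → Digraph n → ℕ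
x {n} h E = length (filter (OnCycle? h (λ u v → T? (E u v))) (allFin n))

-- colourings φ : V → [h]  (colour 1 is the element of Fin h with toℕ = 0)
-- U ⊆ V given as a Bool vector; F = subgraph of G_φ induced by U₁ ∪ V₂ ∪ … ∪ V_h

Colouring : ℕ → ℕ → Set
Colouring n h = Vec (Fin h) n

InV₁ : ∀ {n h} → Colouring n h → Fin n → Set
InV₁ φ v = toℕ (lookup φ v) ≡ 0

Gφ : ∀ {n h} .{{_ : NonZero h}} → Digraph n → Colouring n h → Fin n → Fin n → Set
Gφ E φ u v = Edge E u v × lookup φ v ≡ next (lookup φ u)

InF : ∀ {n h} → Colouring n h → Vec Bool n → Fin n → Set
InF φ U v = (¬ InV₁ φ v) ⊎ (InV₁ φ v × T (lookup U v))

F : ∀ {n h} .{{_ : NonZero h}} → Digraph n → Colouring n h → Vec Bool n → Fin n → Fin n → Set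
F E φ U u v = InF φ U u × InF φ U v × Gφ E φ u v

F? : ∀ {n h} .{{_ : NonZero h}} (E : Digraph n) φ U → ∀ u v → Dec (F E φ U u v)
F? E φ U u v = InF? u ×-dec (InF? v ×-dec (T? (E u v) ×-dec (lookup φ v ≟ᶠ next (lookup φ u))))
  where
  InV₁? : ∀ w → Dec (InV₁ φ w)
  InV₁? w = toℕ (lookup φ w) ℕ.≟ 0
  InF? : ∀ w → Dec (InF φ U w)
  InF? w = ¬? (InV₁? w) ⊎-dec (InV₁? w ×-dec T? (lookup U w))

-- the probability space: φ uniform on [h]^V, and given φ, U₁ ⊆ V₁
-- p-random (each vertex of V₁ independently with probability p).
-- An outcome is (φ , U) with U ∈ Bool^V; U must be ⊆ V₁ (outside V₁ the
-- vertex is never included, weight 1 for 'false' and 0 for 'true').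

allVecs : ∀ {A : Set} → List A → ∀ k → List (Vec A k)
allVecs xs zero = [] ∷ []
allVecs xs (suc k) = concatMap (λ a → map (a ∷_) (allVecs xs k)) xs

sumℚ : List ℚ → ℚ
sumℚ = foldr _+_ 0ℚ

prodℚ : List ℚ → ℚ
prodℚ = foldr _*_ 1ℚ

fromℕℚ : ℕ → ℚ
fromℕℚ m = (+ m) / 1

vertexWeight : ∀ {n h} → ℚ → Colouring n h → Vec Bool n → Fin n → ℚ
vertexWeight p φ U v with toℕ (lookup φ v) ℕ.≟ 0 | lookup U v
... | yes _ | true  = p
... | yes _ | false = 1ℚ - p
... | no _  | true  = 0ℚ
... | no _  | false = 1ℚ

Pr : ∀ (n h : ℕ) .{{_ : NonZero h}} → ℚ →
     (P : Colouring n h → Vec Bool n → Set) → (∀ φ U → Dec (P φ U)) → ℚ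
Pr n h p P P? =
  sumℚ (map (λ φ → sumℚ (map (λ U →
      ((+ 1) / (h ^ n)) {{m^n≢0 h n}}
        * prodℚ (map (vertexWeight p φ U) (allFin n))
        * (if does (P? φ U) then 1ℚ else 0ℚ))
    (allVecs (true ∷ false ∷ []) n)))
    (allVecs (allFin h) n))

FHasCycle : ∀ {n} h .{{_ : NonZero h}} → Digraph n → Colouring n h → Vec Bool n → Set
FHasCycle h E φ U = HasCycle h (F E φ U)

FHasCycle? : ∀ {n} h .{{_ : NonZero h}} (E : Digraph n) → ∀ φ U → Dec (FHasCycle h E φ U)
FHasCycle? h E φ U = HasCycle? h (F? E φ U)

module Submission where

-- For every vertex v on an h-cycle of G fix such a cycle c, with v = c i₀, and let I_v be the
-- event that φ gives c j the colour j − i₀ + 1 (mod h) for every j and that v ∈ U; on I_v the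
-- cycle c survives in F.  I_v constrains every vertex separately, so by independence
-- Pr[I_v] = h⁻ʰ p.  For u ≠ v the event I_u ∧ I_v implies u ∈ U₁ ∧ I_v, which is impossible if
-- u lies on c (u would need colour 1 and another colour) and has probability (p/h) h⁻ʰ p
-- otherwise.  The count Y = Σ_v I_v vanishes unless F has an h-cycle, so
-- 2tY ≤ t² 1[F has an h-cycle] + Y² for every t.  Taking expectations with E[Y] = x h⁻ʰ p,
-- E[Y²] ≤ x h⁻ʰ p (1 + x p / h) and t = x p / h ≥ 4 gives Pr ≥ h⁻ʰ h (1 − 1/t) ≥ h⁻ʰ / 4.

open import Defs
open import Data.Nat as ℕ using (ℕ; zero; suc; NonZero; _*_; _^_)
import Data.Nat.Properties as ℕ
open import Data.Nat.Properties using (m^n≢0; m*n≢0)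
open import Data.Nat.DivMod using (_%_; m%n<n; %-distribˡ-+; m%n%n≡m%n; n%n≡0; [m+n]%n≡m%n; m<n⇒m%n≡m)
open import Data.Integer using (+_)
import Data.Integer as ℤ
import Data.Integer.Properties as ℤ
open import Data.Rational using (ℚ; 0ℚ; 1ℚ; _≤_; _/_; _+_; _-_; -_; fromℚᵘ; Positive; positive; nonNegative)
  renaming (_*_ to _*ℚ_)
import Data.Rational.Properties as ℚ
open import Data.Rational.Unnormalised as ℚᵘ using (mkℚᵘ; *≡*)
import Data.Rational.Unnormalised.Properties as ℚᵘ
open import Data.Rational.Solver using (module +-*-Solver)
open import Data.Fin using (Fin; toℕ; fromℕ<) renaming (zero to fzero; suc to fsuc)
open import Data.Fin.Properties using (suc-injective; all?; any?; ¬∀⟶∃¬; toℕ-fromℕ<; toℕ-injective; toℕ<n)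
  renaming (_≟_ to _≟ᶠ_)
open import Data.List using (List; []; _∷_; map; concatMap; _++_; allFin; length; filter)
import Data.List.Properties as List
open import Data.Vec using (Vec; []; _∷_; lookup)
open import Data.Bool using (Bool; true; false; if_then_else_; T; T?)
import Data.Bool as Bool
open import Data.Empty using (⊥-elim)
open import Data.Product using (_×_; _,_; proj₁; proj₂)
open import Data.Sum using (_⊎_; inj₁; inj₂)
open import Relation.Nullary using (Dec; yes; no; ¬_; does)
open import Relation.Nullary.Decidable using (_×-dec_; _→-dec_)
open import Relation.Binary.PropositionalEquality
open import Function using (_∘_; id; case_of_)
open import Function.Definitions using (Injective)
open import Algebra.Bundles using (CommutativeMonoid)
open import Algebra.Properties.CommutativeSemigroup (CommutativeMonoid.commutativeSemigroup ℚ.+-0-commutativeMonoid)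
  using () renaming (interchange to +-interchange)
open import Algebra.Properties.CommutativeSemigroup (CommutativeMonoid.commutativeSemigroup ℚ.*-1-commutativeMonoid)
  using () renaming (interchange to *-interchange; x∙yz≈y∙xz to *-exchangeˡ)

*-nonNeg : ∀ {a b} → 0ℚ ≤ a → 0ℚ ≤ b → 0ℚ ≤ a *ℚ b
*-nonNeg {a} {b} 0≤a 0≤b = ℚ.nonNegative⁻¹ (a *ℚ b)
  {{ℚ.nonNeg*nonNeg⇒nonNeg a {{nonNegative 0≤a}} b {{nonNegative 0≤b}}}}

+-nonNeg : ∀ {a b} → 0ℚ ≤ a → 0ℚ ≤ b → 0ℚ ≤ a + b
+-nonNeg = ℚ.+-mono-≤

*-monoˡ-≤ : ∀ {c a b} → 0ℚ ≤ c → a ≤ b → c *ℚ a ≤ c *ℚ b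
*-monoˡ-≤ {c} 0≤c = ℚ.*-monoˡ-≤-nonNeg c {{nonNegative 0≤c}}

*-monoʳ-≤ : ∀ {c a b} → 0ℚ ≤ c → a ≤ b → a *ℚ c ≤ b *ℚ c
*-monoʳ-≤ {c} 0≤c = ℚ.*-monoʳ-≤-nonNeg c {{nonNegative 0≤c}}

≤-+-nonNeg : ∀ {a s} → 0ℚ ≤ s → a ≤ a + s
≤-+-nonNeg {a} 0≤s = subst (_≤ a + _) (ℚ.+-identityʳ a) (ℚ.+-monoʳ-≤ a 0≤s)

+-cancelʳ-≤ : ∀ {a b} r → a + r ≤ b + r → a ≤ b
+-cancelʳ-≤ {a} {b} r a+r≤b+r = subst₂ _≤_ (cancel a) (cancel b) (ℚ.+-monoˡ-≤ (- r) a+r≤b+r)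
  where
  cancel : ∀ x → x + r - r ≡ x
  cancel x = trans (ℚ.+-assoc x r (- r)) (trans (cong (_+_ x) (ℚ.+-inverseʳ r)) (ℚ.+-identityʳ x))

p≤q⇒0≤q-p : ∀ {p q} → p ≤ q → 0ℚ ≤ q - p
p≤q⇒0≤q-p {p} {q} p≤q = subst (_≤ q - p) (ℚ.+-inverseʳ p) (ℚ.+-monoˡ-≤ (- p) p≤q)

square-nonNeg : ∀ z → 0ℚ ≤ z *ℚ z
square-nonNeg z with ℚ.≤-total 0ℚ z
... | inj₁ 0≤z = *-nonNeg 0≤z 0≤z
... | inj₂ z≤0 = subst (0ℚ ≤_) (solve 1 (λ z → (:- z) :* (:- z) := z :* z) refl z) (*-nonNeg 0≤-z 0≤-z)
  where
  open +-*-Solver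
  0≤-z : 0ℚ ≤ - z
  0≤-z = ℚ.neg-antimono-≤ z≤0

2ty≤t²+y² : ∀ t y → t *ℚ y + t *ℚ y ≤ t *ℚ t + y *ℚ y
2ty≤t²+y² t y = subst₂ _≤_ (ℚ.+-identityʳ _) square-expansion
  (ℚ.+-monoʳ-≤ (t *ℚ y + t *ℚ y) (square-nonNeg (t - y)))
  where
  open +-*-Solver
  square-expansion : (t *ℚ y + t *ℚ y) + (t - y) *ℚ (t - y) ≡ t *ℚ t + y *ℚ y
  square-expansion = solve 2 (λ t y → (t :* y :+ t :* y) :+ (t :- y) :* (t :- y) := t :* t :+ y :* y) refl t y

-- Equalities between concrete rationals are proved on unnormalised representatives, where
-- they are integer identities.

fromℚᵘ-homo-* : ∀ x y {z} → x ℚᵘ.* y ℚᵘ.≃ z → fromℚᵘ x *ℚ fromℚᵘ y ≡ fromℚᵘ z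
fromℚᵘ-homo-* x y {z} x*y≃z = ℚ.toℚᵘ-injective (ℚᵘ.≃-trans (ℚ.toℚᵘ-homo-* (fromℚᵘ x) (fromℚᵘ y))
  (ℚᵘ.≃-trans (ℚᵘ.*-cong (ℚ.toℚᵘ-fromℚᵘ x) (ℚ.toℚᵘ-fromℚᵘ y))
  (ℚᵘ.≃-trans x*y≃z (ℚᵘ.≃-sym (ℚ.toℚᵘ-fromℚᵘ z)))))

fromℚᵘ-homo-+ : ∀ x y {z} → x ℚᵘ.+ y ℚᵘ.≃ z → fromℚᵘ x + fromℚᵘ y ≡ fromℚᵘ z
fromℚᵘ-homo-+ x y {z} x+y≃z = ℚ.toℚᵘ-injective (ℚᵘ.≃-trans (ℚ.toℚᵘ-homo-+ (fromℚᵘ x) (fromℚᵘ y))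
  (ℚᵘ.≃-trans (ℚᵘ.+-cong (ℚ.toℚᵘ-fromℚᵘ x) (ℚ.toℚᵘ-fromℚᵘ y))
  (ℚᵘ.≃-trans x+y≃z (ℚᵘ.≃-sym (ℚ.toℚᵘ-fromℚᵘ z)))))

fromℕℚ-suc : ∀ m → fromℕℚ (suc m) ≡ 1ℚ + fromℕℚ m
fromℕℚ-suc m = sym (fromℚᵘ-homo-+ (mkℚᵘ (+ 1) 0) (mkℚᵘ (+ m) 0) {mkℚᵘ (+ suc m) 0}
  (*≡* (cong (ℤ._* + 1) (cong (ℤ._+_ (+ 1)) (ℤ.*-identityʳ (+ m))))))

fromℕℚ-* : ∀ m n → fromℕℚ (m * n) ≡ fromℕℚ m *ℚ fromℕℚ n
fromℕℚ-* m n = sym (fromℚᵘ-homo-* (mkℚᵘ (+ m) 0) (mkℚᵘ (+ n) 0) {mkℚᵘ (+ (m * n)) 0}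
  (*≡* (cong (ℤ._* + 1) (sym (ℤ.pos-* m n)))))

fromℕℚ-nonNeg : ∀ m → 0ℚ ≤ fromℕℚ m
fromℕℚ-nonNeg m = ℚ.nonNegative⁻¹ (fromℕℚ m) {{ℚ.normalize-nonNeg m 1}}

1≤fromℕℚ : ∀ m .{{_ : NonZero m}} → 1ℚ ≤ fromℕℚ m
1≤fromℕℚ (suc m) = subst₂ _≤_ (ℚ.+-identityʳ 1ℚ) (sym (fromℕℚ-suc m)) (ℚ.+-monoʳ-≤ 1ℚ (fromℕℚ-nonNeg m))

1/[m*n] : ∀ m n .{{_ : NonZero m}} .{{_ : NonZero n}} →
          ((+ 1) / (m * n)) {{m*n≢0 m n}} ≡ ((+ 1) / m) *ℚ ((+ 1) / n)
1/[m*n] (suc m) (suc n) = sym (fromℚᵘ-homo-* (mkℚᵘ (+ 1) m) (mkℚᵘ (+ 1) n) ℚᵘ.≃-refl)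

m*1/m : ∀ m .{{_ : NonZero m}} → fromℕℚ m *ℚ ((+ 1) / m) ≡ 1ℚ
m*1/m (suc m) = fromℚᵘ-homo-* (mkℚᵘ (+ suc m) 0) (mkℚᵘ (+ 1) m) {mkℚᵘ (+ 1) 0}
  (*≡* (trans (ℤ.*-identityʳ _) (trans (ℤ.*-identityʳ _)
    (trans (cong (λ k → + suc k) (sym (ℕ.+-identityʳ m))) (sym (ℤ.*-identityˡ _))))))

1/m≤1 : ∀ m .{{_ : NonZero m}} → (+ 1) / m ≤ 1ℚ
1/m≤1 m = subst₂ _≤_ (ℚ.*-identityˡ ((+ 1) / m)) (m*1/m m)
  (ℚ.*-monoʳ-≤-nonNeg ((+ 1) / m) {{ℚ.normalize-nonNeg 1 m}} (1≤fromℕℚ m))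

4mᵐ≤a⇒4≤a/m : ∀ m .{{_ : NonZero m}} {a} → fromℕℚ (4 * m ^ m) ≤ a → fromℕℚ 4 ≤ a *ℚ ((+ 1) / m)
4mᵐ≤a⇒4≤a/m m@(suc k) {a} 4mᵐ≤a = begin
  fromℕℚ 4                                      ≡⟨ sym (ℚ.*-identityʳ (fromℕℚ 4)) ⟩
  fromℕℚ 4 *ℚ 1ℚ                                ≤⟨ *-monoˡ-≤ (fromℕℚ-nonNeg 4) (1≤fromℕℚ (m ^ k) {{m^n≢0 m k}}) ⟩
  fromℕℚ 4 *ℚ fromℕℚ (m ^ k)                    ≡⟨ cong (fromℕℚ 4 *ℚ_) (sym mᵐ/m) ⟩
  fromℕℚ 4 *ℚ (fromℕℚ (m * m ^ k) *ℚ m⁻¹)       ≡⟨ sym (ℚ.*-assoc (fromℕℚ 4) (fromℕℚ (m * m ^ k)) m⁻¹) ⟩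
  fromℕℚ 4 *ℚ fromℕℚ (m * m ^ k) *ℚ m⁻¹         ≡⟨ cong (_*ℚ m⁻¹) (sym (fromℕℚ-* 4 (m * m ^ k))) ⟩
  fromℕℚ (4 * m ^ m) *ℚ m⁻¹                     ≤⟨ *-monoʳ-≤ (ℚ.nonNegative⁻¹ m⁻¹ {{ℚ.normalize-nonNeg 1 m}}) 4mᵐ≤a ⟩
  a *ℚ m⁻¹                                      ∎
  where
  open ℚ.≤-Reasoning
  m⁻¹ : ℚ
  m⁻¹ = (+ 1) / m
  mᵐ/m : fromℕℚ (m * m ^ k) *ℚ m⁻¹ ≡ fromℕℚ (m ^ k)
  mᵐ/m = begin-equality
    fromℕℚ (m * m ^ k) *ℚ m⁻¹
      ≡⟨ cong (_*ℚ m⁻¹) (trans (cong fromℕℚ (ℕ.*-comm m (m ^ k))) (fromℕℚ-* (m ^ k) m)) ⟩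
    fromℕℚ (m ^ k) *ℚ fromℕℚ m *ℚ m⁻¹
      ≡⟨ ℚ.*-assoc (fromℕℚ (m ^ k)) (fromℕℚ m) m⁻¹ ⟩
    fromℕℚ (m ^ k) *ℚ (fromℕℚ m *ℚ m⁻¹)
      ≡⟨ cong (fromℕℚ (m ^ k) *ℚ_) (m*1/m m) ⟩
    fromℕℚ (m ^ k) *ℚ 1ℚ
      ≡⟨ ℚ.*-identityʳ (fromℕℚ (m ^ k)) ⟩
    fromℕℚ (m ^ k) ∎

false≢true : false ≢ true
false≢true ()

𝟙 : ∀ {P : Set} → Dec P → ℚ
𝟙 P? = if does P? then 1ℚ else 0ℚ

𝟙-yes : ∀ {P : Set} (P? : Dec P) → P → 𝟙 P? ≡ 1ℚ
𝟙-yes (yes _) _ = refl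
𝟙-yes (no ¬p) p = ⊥-elim (¬p p)

𝟙-no : ∀ {P : Set} (P? : Dec P) → ¬ P → 𝟙 P? ≡ 0ℚ
𝟙-no (yes p) ¬p = ⊥-elim (¬p p)
𝟙-no (no _)  _  = refl

𝟙-nonNeg : ∀ {P : Set} (P? : Dec P) → 0ℚ ≤ 𝟙 P?
𝟙-nonNeg (yes _) = ℚ.nonNegative⁻¹ 1ℚ
𝟙-nonNeg (no _)  = ℚ.≤-refl

𝟙-≤1 : ∀ {P : Set} (P? : Dec P) → 𝟙 P? ≤ 1ℚ
𝟙-≤1 (yes _) = ℚ.≤-refl
𝟙-≤1 (no _)  = ℚ.nonNegative⁻¹ 1ℚ

𝟙-mono : ∀ {P Q : Set} (P? : Dec P) (Q? : Dec Q) → (P → Q) → 𝟙 P? ≤ 𝟙 Q?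
𝟙-mono (yes p) (yes _) P→Q = ℚ.≤-refl
𝟙-mono (yes p) (no ¬q) P→Q = ⊥-elim (¬q (P→Q p))
𝟙-mono (no _)  Q?      P→Q = 𝟙-nonNeg Q?

𝟙-× : ∀ {P Q : Set} (P? : Dec P) (Q? : Dec Q) → 𝟙 (P? ×-dec Q?) ≡ 𝟙 P? *ℚ 𝟙 Q?
𝟙-× (yes _) (yes _) = refl
𝟙-× (yes _) (no _)  = refl
𝟙-× (no _)  Q?      = sym (ℚ.*-zeroˡ (𝟙 Q?))

𝟙-×-yesˡ : ∀ {P Q : Set} (P? : Dec P) (Q? : Dec Q) → P → 𝟙 (P? ×-dec Q?) ≡ 𝟙 Q?
𝟙-×-yesˡ (yes _) Q? _ = refl
𝟙-×-yesˡ (no ¬p) Q? p = ⊥-elim (¬p p)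

𝟙-×-yesʳ : ∀ {P Q : Set} (P? : Dec P) (Q? : Dec Q) → Q → 𝟙 (P? ×-dec Q?) ≡ 𝟙 P?
𝟙-×-yesʳ P? (yes q) _ = trans (𝟙-× P? (yes q)) (ℚ.*-identityʳ (𝟙 P?))
𝟙-×-yesʳ P? (no ¬q) q = ⊥-elim (¬q q)

∑ : ∀ {A : Set} → List A → (A → ℚ) → ℚ
∑ L f = sumℚ (map f L)

∏ : ∀ {A : Set} → List A → (A → ℚ) → ℚ
∏ L f = prodℚ (map f L)

module _ {A : Set} where

  ∑-cong : ∀ (L : List A) {f g : A → ℚ} → (∀ a → f a ≡ g a) → ∑ L f ≡ ∑ L g
  ∑-cong []      f≗g = refl
  ∑-cong (a ∷ L) f≗g = cong₂ _+_ (f≗g a) (∑-cong L f≗g)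

  ∏-cong : ∀ (L : List A) {f g : A → ℚ} → (∀ a → f a ≡ g a) → ∏ L f ≡ ∏ L g
  ∏-cong []      f≗g = refl
  ∏-cong (a ∷ L) f≗g = cong₂ _*ℚ_ (f≗g a) (∏-cong L f≗g)

  ∑-zero : ∀ (L : List A) {f : A → ℚ} → (∀ a → f a ≡ 0ℚ) → ∑ L f ≡ 0ℚ
  ∑-zero []      f≗0 = refl
  ∑-zero (a ∷ L) f≗0 = trans (cong₂ _+_ (f≗0 a) (∑-zero L f≗0)) (ℚ.+-identityˡ 0ℚ)

  ∏-one : ∀ (L : List A) {f : A → ℚ} → (∀ a → f a ≡ 1ℚ) → ∏ L f ≡ 1ℚ
  ∏-one []      f≗1 = refl
  ∏-one (a ∷ L) f≗1 = trans (cong₂ _*ℚ_ (f≗1 a) (∏-one L f≗1)) (ℚ.*-identityˡ 1ℚ)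

  ∑-mono-≤ : ∀ (L : List A) {f g : A → ℚ} → (∀ a → f a ≤ g a) → ∑ L f ≤ ∑ L g
  ∑-mono-≤ []      f≤g = ℚ.≤-refl
  ∑-mono-≤ (a ∷ L) f≤g = ℚ.+-mono-≤ (f≤g a) (∑-mono-≤ L f≤g)

  ∏-nonNeg : ∀ (L : List A) {f : A → ℚ} → (∀ a → 0ℚ ≤ f a) → 0ℚ ≤ ∏ L f
  ∏-nonNeg []      0≤f = ℚ.nonNegative⁻¹ 1ℚ
  ∏-nonNeg (a ∷ L) 0≤f = *-nonNeg (0≤f a) (∏-nonNeg L 0≤f)

  ∑-distrib-+ : ∀ (L : List A) (f g : A → ℚ) → ∑ L (λ a → f a + g a) ≡ ∑ L f + ∑ L g
  ∑-distrib-+ []      f g = refl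
  ∑-distrib-+ (a ∷ L) f g = begin
    (f a + g a) + ∑ L (λ a → f a + g a) ≡⟨ cong (_+_ (f a + g a)) (∑-distrib-+ L f g) ⟩
    (f a + g a) + (∑ L f + ∑ L g)       ≡⟨ +-interchange (f a) (g a) (∑ L f) (∑ L g) ⟩
    (f a + ∑ L f) + (g a + ∑ L g)       ∎
    where open ≡-Reasoning

  ∏-distrib-* : ∀ (L : List A) (f g : A → ℚ) → ∏ L (λ a → f a *ℚ g a) ≡ ∏ L f *ℚ ∏ L g
  ∏-distrib-* []      f g = refl
  ∏-distrib-* (a ∷ L) f g = begin
    (f a *ℚ g a) *ℚ ∏ L (λ a → f a *ℚ g a) ≡⟨ cong ((f a *ℚ g a) *ℚ_) (∏-distrib-* L f g) ⟩
    (f a *ℚ g a) *ℚ (∏ L f *ℚ ∏ L g)       ≡⟨ *-interchange (f a) (g a) (∏ L f) (∏ L g) ⟩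
    (f a *ℚ ∏ L f) *ℚ (g a *ℚ ∏ L g)       ∎
    where open ≡-Reasoning

  *-distribˡ-∑ : ∀ (L : List A) (c : ℚ) (f : A → ℚ) → c *ℚ ∑ L f ≡ ∑ L (λ a → c *ℚ f a)
  *-distribˡ-∑ []      c f = ℚ.*-zeroʳ c
  *-distribˡ-∑ (a ∷ L) c f =
    trans (ℚ.*-distribˡ-+ c (f a) (∑ L f)) (cong (_+_ (c *ℚ f a)) (*-distribˡ-∑ L c f))

  *-distribʳ-∑ : ∀ (L : List A) (c : ℚ) (f : A → ℚ) → ∑ L f *ℚ c ≡ ∑ L (λ a → f a *ℚ c)
  *-distribʳ-∑ L c f = begin
    ∑ L f *ℚ c             ≡⟨ ℚ.*-comm (∑ L f) c ⟩
    c *ℚ ∑ L f             ≡⟨ *-distribˡ-∑ L c f ⟩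
    ∑ L (λ a → c *ℚ f a)   ≡⟨ ∑-cong L (λ a → ℚ.*-comm c (f a)) ⟩
    ∑ L (λ a → f a *ℚ c)   ∎
    where open ≡-Reasoning

  ∑-const : ∀ (L : List A) (c : ℚ) → ∑ L (λ _ → c) ≡ fromℕℚ (length L) *ℚ c
  ∑-const []      c = sym (ℚ.*-zeroˡ c)
  ∑-const (a ∷ L) c = begin
    c + ∑ L (λ _ → c)                  ≡⟨ cong₂ _+_ (sym (ℚ.*-identityˡ c)) (∑-const L c) ⟩
    1ℚ *ℚ c + fromℕℚ (length L) *ℚ c   ≡⟨ sym (ℚ.*-distribʳ-+ c 1ℚ (fromℕℚ (length L))) ⟩
    (1ℚ + fromℕℚ (length L)) *ℚ c      ≡⟨ cong (_*ℚ c) (sym (fromℕℚ-suc (length L))) ⟩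
    fromℕℚ (suc (length L)) *ℚ c       ∎
    where open ≡-Reasoning

  ∑-count : ∀ {P : A → Set} (P? : ∀ a → Dec (P a)) (L : List A) →
            ∑ L (𝟙 ∘ P?) ≡ fromℕℚ (length (filter P? L))
  ∑-count P? []      = refl
  ∑-count P? (a ∷ L) with does (P? a)
  ... | true  = trans (cong (_+_ 1ℚ) (∑-count P? L)) (sym (fromℕℚ-suc (length (filter P? L))))
  ... | false = trans (ℚ.+-identityˡ _) (∑-count P? L)

  ∑-++ : ∀ (L M : List A) (f : A → ℚ) → ∑ (L ++ M) f ≡ ∑ L f + ∑ M f
  ∑-++ []      M f = sym (ℚ.+-identityˡ _)
  ∑-++ (a ∷ L) M f = trans (cong (_+_ (f a)) (∑-++ L M f)) (sym (ℚ.+-assoc (f a) (∑ L f) (∑ M f)))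

  ∑-map : ∀ {B : Set} (L : List B) (g : B → A) (f : A → ℚ) → ∑ (map g L) f ≡ ∑ L (f ∘ g)
  ∑-map []      g f = refl
  ∑-map (b ∷ L) g f = cong (_+_ (f (g b))) (∑-map L g f)

  ∑-concatMap : ∀ {B : Set} (L : List B) (g : B → List A) (f : A → ℚ) →
                ∑ (concatMap g L) f ≡ ∑ L (λ b → ∑ (g b) f)
  ∑-concatMap []      g f = refl
  ∑-concatMap (b ∷ L) g f =
    trans (∑-++ (g b) (concatMap g L) f) (cong (_+_ (∑ (g b) f)) (∑-concatMap L g f))

map-allFin-suc : ∀ {A : Set} n (f : Fin (suc n) → A) →
                 map f (allFin (suc n)) ≡ f fzero ∷ map (f ∘ fsuc) (allFin n)
map-allFin-suc n f =
  trans (List.map-tabulate id f) (cong (f fzero ∷_) (sym (List.map-tabulate id (f ∘ fsuc))))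

∑-allFin-suc : ∀ n (f : Fin (suc n) → ℚ) → ∑ (allFin (suc n)) f ≡ f fzero + ∑ (allFin n) (f ∘ fsuc)
∑-allFin-suc n f = cong sumℚ (map-allFin-suc n f)

∏-allFin-suc : ∀ n (f : Fin (suc n) → ℚ) → ∏ (allFin (suc n)) f ≡ f fzero *ℚ ∏ (allFin n) (f ∘ fsuc)
∏-allFin-suc n f = cong prodℚ (map-allFin-suc n f)

∑-delta : ∀ {m} (d : Fin m) (f : Fin m → ℚ) → (∀ w → w ≢ d → f w ≡ 0ℚ) → ∑ (allFin m) f ≡ f d
∑-delta {suc m} fzero f off = begin
  ∑ (allFin (suc m)) f                 ≡⟨ ∑-allFin-suc m f ⟩
  f fzero + ∑ (allFin m) (f ∘ fsuc)    ≡⟨ cong (_+_ (f fzero)) (∑-zero (allFin m) (λ w → off (fsuc w) λ ())) ⟩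
  f fzero + 0ℚ                         ≡⟨ ℚ.+-identityʳ (f fzero) ⟩
  f fzero                              ∎
  where open ≡-Reasoning
∑-delta {suc m} (fsuc d) f off = begin
  ∑ (allFin (suc m)) f                 ≡⟨ ∑-allFin-suc m f ⟩
  f fzero + ∑ (allFin m) (f ∘ fsuc)    ≡⟨ cong₂ _+_ (off fzero λ ()) (∑-delta d (f ∘ fsuc) off-d) ⟩
  0ℚ + f (fsuc d)                      ≡⟨ ℚ.+-identityˡ (f (fsuc d)) ⟩
  f (fsuc d)                           ∎
  where
  open ≡-Reasoning
  off-d : ∀ w → w ≢ d → f (fsuc w) ≡ 0ℚ
  off-d w w≢d = off (fsuc w) (w≢d ∘ suc-injective)

∏-zero : ∀ {m} (d : Fin m) (f : Fin m → ℚ) → f d ≡ 0ℚ → ∏ (allFin m) f ≡ 0ℚ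
∏-zero {suc m} fzero    f fd≡0 = begin
  ∏ (allFin (suc m)) f                 ≡⟨ ∏-allFin-suc m f ⟩
  f fzero *ℚ ∏ (allFin m) (f ∘ fsuc)   ≡⟨ cong (_*ℚ ∏ (allFin m) (f ∘ fsuc)) fd≡0 ⟩
  0ℚ *ℚ ∏ (allFin m) (f ∘ fsuc)        ≡⟨ ℚ.*-zeroˡ (∏ (allFin m) (f ∘ fsuc)) ⟩
  0ℚ                                   ∎
  where open ≡-Reasoning
∏-zero {suc m} (fsuc d) f fd≡0 = begin
  ∏ (allFin (suc m)) f                 ≡⟨ ∏-allFin-suc m f ⟩
  f fzero *ℚ ∏ (allFin m) (f ∘ fsuc)   ≡⟨ cong (f fzero *ℚ_) (∏-zero d (f ∘ fsuc) fd≡0) ⟩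
  f fzero *ℚ 0ℚ                        ≡⟨ ℚ.*-zeroʳ (f fzero) ⟩
  0ℚ                                   ∎
  where open ≡-Reasoning

_[_]≔1 : ∀ {m} → (Fin m → ℚ) → Fin m → Fin m → ℚ
(f [ d ]≔1) w = if does (w ≟ᶠ d) then 1ℚ else f w

[≔1]-off : ∀ {m} (f : Fin m → ℚ) {d w} → w ≢ d → (f [ d ]≔1) w ≡ f w
[≔1]-off f {d} {w} w≢d with w ≟ᶠ d
... | yes w≡d = ⊥-elim (w≢d w≡d)
... | no _    = refl

∏-extract : ∀ {m} (d : Fin m) (f : Fin m → ℚ) → ∏ (allFin m) f ≡ f d *ℚ ∏ (allFin m) (f [ d ]≔1)
∏-extract {suc m} fzero f = begin
  ∏ (allFin (suc m)) f                          ≡⟨ ∏-allFin-suc m f ⟩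
  f fzero *ℚ ∏ (allFin m) (f ∘ fsuc)            ≡⟨ cong (f fzero *ℚ_) (sym (ℚ.*-identityˡ _)) ⟩
  f fzero *ℚ (1ℚ *ℚ ∏ (allFin m) (f ∘ fsuc))    ≡⟨ cong (f fzero *ℚ_) (sym (∏-allFin-suc m (f [ fzero ]≔1))) ⟩
  f fzero *ℚ ∏ (allFin (suc m)) (f [ fzero ]≔1) ∎
  where open ≡-Reasoning
∏-extract {suc m} (fsuc d) f = begin
  ∏ (allFin (suc m)) f
    ≡⟨ ∏-allFin-suc m f ⟩
  f fzero *ℚ ∏ (allFin m) (f ∘ fsuc)
    ≡⟨ cong (f fzero *ℚ_) (∏-extract d (f ∘ fsuc)) ⟩
  f fzero *ℚ (f (fsuc d) *ℚ ∏ (allFin m) ((f ∘ fsuc) [ d ]≔1))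
    ≡⟨ *-exchangeˡ (f fzero) (f (fsuc d)) _ ⟩
  f (fsuc d) *ℚ (f fzero *ℚ ∏ (allFin m) ((f ∘ fsuc) [ d ]≔1))
    ≡⟨ cong (f (fsuc d) *ℚ_) (sym (∏-allFin-suc m (f [ fsuc d ]≔1))) ⟩
  f (fsuc d) *ℚ ∏ (allFin (suc m)) (f [ fsuc d ]≔1) ∎
  where open ≡-Reasoning

∏-delta : ∀ {m} (d : Fin m) (f : Fin m → ℚ) → (∀ w → w ≢ d → f w ≡ 1ℚ) → ∏ (allFin m) f ≡ f d
∏-delta {m} d f off = begin
  ∏ (allFin m) f                    ≡⟨ ∏-extract d f ⟩
  f d *ℚ ∏ (allFin m) (f [ d ]≔1)   ≡⟨ cong (f d *ℚ_) (∏-one (allFin m) f[d]≔1≗1) ⟩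
  f d *ℚ 1ℚ                         ≡⟨ ℚ.*-identityʳ (f d) ⟩
  f d                               ∎
  where
  open ≡-Reasoning
  f[d]≔1≗1 : ∀ w → (f [ d ]≔1) w ≡ 1ℚ
  f[d]≔1≗1 w with w ≟ᶠ d
  ... | yes _   = refl
  ... | no w≢d = off w w≢d

∏-image : ∀ {k m} (e : Fin k → Fin m) → Injective _≡_ _≡_ e → (f : Fin m → ℚ) →
          (∀ w → (∀ j → e j ≢ w) → f w ≡ 1ℚ) → ∏ (allFin m) f ≡ ∏ (allFin k) (f ∘ e)
∏-image {zero}  {m} e e-inj f off = ∏-one (allFin m) (λ w → off w λ ())
∏-image {suc k} {m} e e-inj f off = begin
  ∏ (allFin m) f
    ≡⟨ ∏-extract (e fzero) f ⟩
  f (e fzero) *ℚ ∏ (allFin m) f′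
    ≡⟨ cong (f (e fzero) *ℚ_) (∏-image (e ∘ fsuc) (suc-injective ∘ e-inj) f′ off′) ⟩
  f (e fzero) *ℚ ∏ (allFin k) (f′ ∘ e ∘ fsuc)
    ≡⟨ cong (f (e fzero) *ℚ_) (∏-cong (allFin k) f′∘e≗f∘e) ⟩
  f (e fzero) *ℚ ∏ (allFin k) (f ∘ e ∘ fsuc)
    ≡⟨ sym (∏-allFin-suc k (f ∘ e)) ⟩
  ∏ (allFin (suc k)) (f ∘ e) ∎
  where
  open ≡-Reasoning
  f′ : Fin m → ℚ
  f′ = f [ e fzero ]≔1
  f′∘e≗f∘e : ∀ j → f′ (e (fsuc j)) ≡ f (e (fsuc j))
  f′∘e≗f∘e j = [≔1]-off f (λ e[1+j]≡e[0] → case e-inj e[1+j]≡e[0] of λ ())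
  off′ : ∀ w → (∀ j → e (fsuc j) ≢ w) → f′ w ≡ 1ℚ
  off′ w w∉e[suc] with w ≟ᶠ e fzero
  ... | yes _        = refl
  ... | no w≢e[zero] = off w λ { fzero e0≡w → w≢e[zero] (sym e0≡w) ; (fsuc j) → w∉e[suc] j }

𝟙-∏ : ∀ {m} {Q : Fin m → Set} (Q? : ∀ w → Dec (Q w)) → ∏ (allFin m) (𝟙 ∘ Q?) ≡ 𝟙 (all? Q?)
𝟙-∏ {m} {Q} Q? = go (all? Q?)
  where
  go : (∀Q? : Dec (∀ w → Q w)) → ∏ (allFin m) (𝟙 ∘ Q?) ≡ 𝟙 ∀Q?
  go (yes ∀Q) = ∏-one (allFin m) (λ w → 𝟙-yes (Q? w) (∀Q w))
  go (no ¬∀Q) with ¬∀⟶∃¬ m Q Q? ¬∀Q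
  ... | w , ¬Qw = ∏-zero w (𝟙 ∘ Q?) (𝟙-no (Q? w) ¬Qw)

1/[m^k] : ∀ m k .{{_ : NonZero m}} → ((+ 1) / (m ^ k)) {{m^n≢0 m k}} ≡ ∏ (allFin k) (λ _ → (+ 1) / m)
1/[m^k] m zero              = refl
1/[m^k] m (suc k) {{m≢0}} = begin
  ((+ 1) / (m ^ suc k)) {{m^n≢0 m (suc k)}}       ≡⟨ 1/[m*n] m (m ^ k) {{m≢0}} {{m^n≢0 m k}} ⟩
  (+ 1) / m *ℚ ((+ 1) / (m ^ k)) {{m^n≢0 m k}}    ≡⟨ cong ((+ 1) / m *ℚ_) (1/[m^k] m k) ⟩
  (+ 1) / m *ℚ ∏ (allFin k) (λ _ → (+ 1) / m)     ≡⟨ sym (∏-allFin-suc k (λ _ → (+ 1) / m)) ⟩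
  ∏ (allFin (suc k)) (λ _ → (+ 1) / m)            ∎
  where open ≡-Reasoning

∑-allVecs-suc : ∀ {A : Set} (xs : List A) k (f : Vec A (suc k) → ℚ) →
                ∑ (allVecs xs (suc k)) f ≡ ∑ xs (λ a → ∑ (allVecs xs k) (λ v → f (a ∷ v)))
∑-allVecs-suc xs k f =
  trans (∑-concatMap xs _ f) (∑-cong xs (λ a → ∑-map (allVecs xs k) (a ∷_) f))

∑-allVecs-∏ : ∀ {A : Set} (xs : List A) n (F : Fin n → A → ℚ) →
              ∑ (allVecs xs n) (λ v → ∏ (allFin n) (λ w → F w (lookup v w))) ≡ ∏ (allFin n) (λ w → ∑ xs (F w))
∑-allVecs-∏ xs zero F = ℚ.+-identityʳ 1ℚ
∑-allVecs-∏ {A} xs (suc n) F = begin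
  ∑ (allVecs xs (suc n)) (λ v → ∏ (allFin (suc n)) (λ w → F w (lookup v w)))
    ≡⟨ ∑-allVecs-suc xs n _ ⟩
  ∑ xs (λ a → ∑ (allVecs xs n) (λ v → ∏ (allFin (suc n)) (λ w → F w (lookup (a ∷ v) w))))
    ≡⟨ ∑-cong xs (λ a → ∑-cong (allVecs xs n) (λ v → ∏-allFin-suc n (λ w → F w (lookup (a ∷ v) w)))) ⟩
  ∑ xs (λ a → ∑ (allVecs xs n) (λ v → F fzero a *ℚ rest v))
    ≡⟨ ∑-cong xs (λ a → sym (*-distribˡ-∑ (allVecs xs n) (F fzero a) rest)) ⟩
  ∑ xs (λ a → F fzero a *ℚ ∑ (allVecs xs n) rest)
    ≡⟨ ∑-cong xs (λ a → cong (F fzero a *ℚ_) (∑-allVecs-∏ xs n (F ∘ fsuc))) ⟩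
  ∑ xs (λ a → F fzero a *ℚ ∏ (allFin n) (λ w → ∑ xs (F (fsuc w))))
    ≡⟨ sym (*-distribʳ-∑ xs _ (F fzero)) ⟩
  ∑ xs (F fzero) *ℚ ∏ (allFin n) (λ w → ∑ xs (F (fsuc w)))
    ≡⟨ sym (∏-allFin-suc n (λ w → ∑ xs (F w))) ⟩
  ∏ (allFin (suc n)) (λ w → ∑ xs (F w)) ∎
  where
  open ≡-Reasoning
  rest : Vec A n → ℚ
  rest v = ∏ (allFin n) (λ w → F (fsuc w) (lookup v w))

[m%n+k]%n≡[m+k]%n : ∀ m k n .{{_ : NonZero n}} → (m % n ℕ.+ k) % n ≡ (m ℕ.+ k) % n
[m%n+k]%n≡[m+k]%n m k n = begin
  (m % n ℕ.+ k) % n             ≡⟨ %-distribˡ-+ (m % n) k n ⟩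
  (m % n % n ℕ.+ k % n) % n     ≡⟨ cong (λ r → (r ℕ.+ k % n) % n) (m%n%n≡m%n m n) ⟩
  (m % n ℕ.+ k % n) % n         ≡⟨ sym (%-distribˡ-+ m k n) ⟩
  (m ℕ.+ k) % n                 ∎
  where open ≡-Reasoning

module _ {h : ℕ} .{{_ : NonZero h}} where

  -- The colour j − i (mod h) of the j-th vertex of a cycle whose i-th vertex gets colour 1,
  -- the colour with toℕ 0.
  shift : Fin h → Fin h → Fin h
  shift i j = fromℕ< (m%n<n (toℕ j ℕ.+ (h ℕ.∸ toℕ i)) h)

  toℕ-shift : ∀ i j → toℕ (shift i j) ≡ (toℕ j ℕ.+ (h ℕ.∸ toℕ i)) % h
  toℕ-shift i j = toℕ-fromℕ< _

  toℕ-next : ∀ (j : Fin h) → toℕ (next j) ≡ suc (toℕ j) % h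
  toℕ-next j = toℕ-fromℕ< _

  toℕ-shift-self : ∀ i → toℕ (shift i i) ≡ 0
  toℕ-shift-self i = begin
    toℕ (shift i i)                 ≡⟨ toℕ-shift i i ⟩
    (toℕ i ℕ.+ (h ℕ.∸ toℕ i)) % h   ≡⟨ cong (_% h) (ℕ.m+[n∸m]≡n (ℕ.<⇒≤ (toℕ<n i))) ⟩
    h % h                           ≡⟨ n%n≡0 h ⟩
    0                               ∎
    where open ≡-Reasoning

  shift-next : ∀ i j → shift i (next j) ≡ next (shift i j)
  shift-next i j = toℕ-injective (begin
    toℕ (shift i (next j))               ≡⟨ toℕ-shift i (next j) ⟩
    (toℕ (next j) ℕ.+ d) % h             ≡⟨ cong (λ r → (r ℕ.+ d) % h) (toℕ-next j) ⟩
    (suc (toℕ j) % h ℕ.+ d) % h          ≡⟨ [m%n+k]%n≡[m+k]%n (suc (toℕ j)) d h ⟩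
    suc (toℕ j ℕ.+ d) % h                ≡⟨ cong (_% h) (ℕ.+-comm 1 (toℕ j ℕ.+ d)) ⟩
    (toℕ j ℕ.+ d ℕ.+ 1) % h              ≡⟨ sym ([m%n+k]%n≡[m+k]%n (toℕ j ℕ.+ d) 1 h) ⟩
    ((toℕ j ℕ.+ d) % h ℕ.+ 1) % h        ≡⟨ cong (_% h) (ℕ.+-comm _ 1) ⟩
    suc ((toℕ j ℕ.+ d) % h) % h          ≡⟨ cong (λ r → suc r % h) (sym (toℕ-shift i j)) ⟩
    suc (toℕ (shift i j)) % h            ≡⟨ sym (toℕ-next (shift i j)) ⟩
    toℕ (next (shift i j))               ∎)
    where
    open ≡-Reasoning
    d : ℕ
    d = h ℕ.∸ toℕ i

  shift≡0⇒≡ : ∀ i j → toℕ (shift i j) ≡ 0 → j ≡ i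
  shift≡0⇒≡ i j shift≡0 = toℕ-injective (begin
    toℕ j                                  ≡⟨ sym (m<n⇒m%n≡m (toℕ<n j)) ⟩
    toℕ j % h                              ≡⟨ sym ([m+n]%n≡m%n (toℕ j) h) ⟩
    (toℕ j ℕ.+ h) % h                      ≡⟨ cong (λ r → (toℕ j ℕ.+ r) % h) (sym (ℕ.m∸n+n≡m (ℕ.<⇒≤ (toℕ<n i)))) ⟩
    (toℕ j ℕ.+ (d ℕ.+ toℕ i)) % h          ≡⟨ cong (_% h) (sym (ℕ.+-assoc (toℕ j) d (toℕ i))) ⟩
    (toℕ j ℕ.+ d ℕ.+ toℕ i) % h            ≡⟨ sym ([m%n+k]%n≡[m+k]%n (toℕ j ℕ.+ d) (toℕ i) h) ⟩
    ((toℕ j ℕ.+ d) % h ℕ.+ toℕ i) % h      ≡⟨ cong (λ r → (r ℕ.+ toℕ i) % h) (trans (sym (toℕ-shift i j)) shift≡0) ⟩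
    toℕ i % h                              ≡⟨ m<n⇒m%n≡m (toℕ<n i) ⟩
    toℕ i                                  ∎)
    where
    open ≡-Reasoning
    d : ℕ
    d = h ℕ.∸ toℕ i

module RandomColouring {n h : ℕ} .{{_ : NonZero h}} (p : ℚ) (0≤p : 0ℚ ≤ p) (p≤1 : p ≤ 1ℚ) where

  h⁻¹ : ℚ
  h⁻¹ = (+ 1) / h

  h⁻¹-nonNeg : 0ℚ ≤ h⁻¹
  h⁻¹-nonNeg = ℚ.nonNegative⁻¹ h⁻¹ {{ℚ.normalize-nonNeg 1 h}}

  h⁻ʰ : ℚ
  h⁻ʰ = ∏ (allFin h) (λ _ → h⁻¹)

  h⁻ʰ-nonNeg : 0ℚ ≤ h⁻ʰ
  h⁻ʰ-nonNeg = ∏-nonNeg (allFin h) (λ _ → h⁻¹-nonNeg)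

  ∑-allFin-h⁻¹ : ∑ (allFin h) (λ _ → h⁻¹) ≡ 1ℚ
  ∑-allFin-h⁻¹ = begin
    ∑ (allFin h) (λ _ → h⁻¹)              ≡⟨ ∑-const (allFin h) h⁻¹ ⟩
    fromℕℚ (length (allFin h)) *ℚ h⁻¹     ≡⟨ cong (λ k → fromℕℚ k *ℚ h⁻¹) (List.length-tabulate {n = h} id) ⟩
    fromℕℚ h *ℚ h⁻¹                       ≡⟨ m*1/m h ⟩
    1ℚ                                    ∎
    where open ≡-Reasoning

  weight : Fin h → Bool → ℚ
  weight a b with toℕ a ℕ.≟ 0 | b
  ... | yes _ | true  = p
  ... | yes _ | false = 1ℚ - p
  ... | no _  | true  = 0ℚ
  ... | no _  | false = 1ℚ

  vertexWeight≡weight : ∀ (φ : Colouring n h) U w → vertexWeight p φ U w ≡ weight (lookup φ w) (lookup U w)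
  vertexWeight≡weight φ U w with toℕ (lookup φ w) ℕ.≟ 0 | lookup U w
  ... | yes _ | true  = refl
  ... | yes _ | false = refl
  ... | no _  | true  = refl
  ... | no _  | false = refl

  weight-nonNeg : ∀ a b → 0ℚ ≤ weight a b
  weight-nonNeg a b with toℕ a ℕ.≟ 0 | b
  ... | yes _ | true  = 0≤p
  ... | yes _ | false = p≤q⇒0≤q-p p≤1
  ... | no _  | true  = ℚ.≤-refl
  ... | no _  | false = ℚ.nonNegative⁻¹ 1ℚ

  weight-total : ∀ a → weight a true *ℚ 1ℚ + weight a false *ℚ 1ℚ ≡ 1ℚ
  weight-total a with toℕ a ℕ.≟ 0
  ... | yes _ = solve 1 (λ x → x :* con 1ℚ :+ (con 1ℚ :- x) :* con 1ℚ := con 1ℚ) refl p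
    where open +-*-Solver
  ... | no _  = refl

  weight-selected : ∀ a → toℕ a ≡ 0 → weight a true *ℚ 1ℚ + weight a false *ℚ 0ℚ ≡ p
  weight-selected a a≡0 with toℕ a ℕ.≟ 0
  ... | yes _   = solve 1 (λ x → x :* con 1ℚ :+ (con 1ℚ :- x) :* con 0ℚ := x) refl p
    where open +-*-Solver
  ... | no a≢0 = ⊥-elim (a≢0 a≡0)

  bools : List Bool
  bools = true ∷ false ∷ []

  𝔼₁ : (Fin h → Bool → ℚ) → ℚ
  𝔼₁ G = ∑ (allFin h) (λ a → ∑ bools (λ b → h⁻¹ *ℚ (weight a b *ℚ G a b)))

  𝔼₁-cong : ∀ {G G′ : Fin h → Bool → ℚ} → (∀ a b → G a b ≡ G′ a b) → 𝔼₁ G ≡ 𝔼₁ G′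
  𝔼₁-cong G≗G′ = ∑-cong (allFin h) (λ a → ∑-cong bools (λ b → cong (λ g → h⁻¹ *ℚ (weight a b *ℚ g)) (G≗G′ a b)))

  weighted-zero : ∀ a b {g} → g ≡ 0ℚ → h⁻¹ *ℚ (weight a b *ℚ g) ≡ 0ℚ
  weighted-zero a b refl = trans (cong (h⁻¹ *ℚ_) (ℚ.*-zeroʳ (weight a b))) (ℚ.*-zeroʳ h⁻¹)

  weighted-∑-bools : ∀ (G : Fin h → Bool → ℚ) a → ∑ bools (λ b → h⁻¹ *ℚ (weight a b *ℚ G a b))
                                                ≡ h⁻¹ *ℚ (weight a true *ℚ G a true + weight a false *ℚ G a false)
  weighted-∑-bools G a = trans (cong (_+_ (h⁻¹ *ℚ (weight a true *ℚ G a true))) (ℚ.+-identityʳ _))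
                               (sym (ℚ.*-distribˡ-+ h⁻¹ _ _))

  𝔼₁-one : 𝔼₁ (λ _ _ → 1ℚ) ≡ 1ℚ
  𝔼₁-one = trans (∑-cong (allFin h) row) ∑-allFin-h⁻¹
    where
    row : ∀ a → ∑ bools (λ b → h⁻¹ *ℚ (weight a b *ℚ 1ℚ)) ≡ h⁻¹
    row a = trans (weighted-∑-bools (λ _ _ → 1ℚ) a) (trans (cong (h⁻¹ *ℚ_) (weight-total a)) (ℚ.*-identityʳ h⁻¹))

  𝔼₁-zero : ∀ {G : Fin h → Bool → ℚ} → (∀ a b → G a b ≡ 0ℚ) → 𝔼₁ G ≡ 0ℚ
  𝔼₁-zero G≗0 = ∑-zero (allFin h) (λ a → ∑-zero bools (λ b → weighted-zero a b (G≗0 a b)))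

  𝔼₁-point : ∀ (G : Fin h → Bool → ℚ) α {x y} → (∀ a b → a ≢ α → G a b ≡ 0ℚ) →
             G α true ≡ x → G α false ≡ y → 𝔼₁ G ≡ h⁻¹ *ℚ (weight α true *ℚ x + weight α false *ℚ y)
  𝔼₁-point G α {x} {y} off G-true G-false = begin
    𝔼₁ G                                                                 ≡⟨ ∑-delta α _ off-α ⟩
    ∑ bools (λ b → h⁻¹ *ℚ (weight α b *ℚ G α b))                         ≡⟨ weighted-∑-bools G α ⟩
    h⁻¹ *ℚ (weight α true *ℚ G α true + weight α false *ℚ G α false)
      ≡⟨ cong₂ (λ x y → h⁻¹ *ℚ (weight α true *ℚ x + weight α false *ℚ y)) G-true G-false ⟩
    h⁻¹ *ℚ (weight α true *ℚ x + weight α false *ℚ y)                   ∎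
    where
    open ≡-Reasoning
    off-α : ∀ a → a ≢ α → ∑ bools (λ b → h⁻¹ *ℚ (weight a b *ℚ G a b)) ≡ 0ℚ
    off-α a a≢α = ∑-zero bools (λ b → weighted-zero a b (off a b a≢α))

  RandomVariable : Set
  RandomVariable = Colouring n h → Vec Bool n → ℚ

  Φs : List (Colouring n h)
  Φs = allVecs (allFin h) n

  Us : List (Vec Bool n)
  Us = allVecs bools n

  mass : RandomVariable
  mass φ U = ((+ 1) / (h ^ n)) {{m^n≢0 h n}} *ℚ ∏ (allFin n) (vertexWeight p φ U)

  𝔼 : RandomVariable → ℚ
  𝔼 f = ∑ Φs (λ φ → ∑ Us (λ U → mass φ U *ℚ f φ U))

  Pr≡𝔼𝟙 : ∀ {P : Colouring n h → Vec Bool n → Set} (P? : ∀ φ U → Dec (P φ U)) →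
          Pr n h p P P? ≡ 𝔼 (λ φ U → 𝟙 (P? φ U))
  Pr≡𝔼𝟙 P? = refl

  mass≡∏ : ∀ φ U → mass φ U ≡ ∏ (allFin n) (λ w → h⁻¹ *ℚ weight (lookup φ w) (lookup U w))
  mass≡∏ φ U = begin
    ((+ 1) / (h ^ n)) {{m^n≢0 h n}} *ℚ ∏ (allFin n) (vertexWeight p φ U)
      ≡⟨ cong₂ _*ℚ_ (1/[m^k] h n) (∏-cong (allFin n) (vertexWeight≡weight φ U)) ⟩
    ∏ (allFin n) (λ _ → h⁻¹) *ℚ ∏ (allFin n) (λ w → weight (lookup φ w) (lookup U w))
      ≡⟨ sym (∏-distrib-* (allFin n) _ _) ⟩
    ∏ (allFin n) (λ w → h⁻¹ *ℚ weight (lookup φ w) (lookup U w)) ∎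
    where open ≡-Reasoning

  mass-nonNeg : ∀ φ U → 0ℚ ≤ mass φ U
  mass-nonNeg φ U = subst (0ℚ ≤_) (sym (mass≡∏ φ U))
    (∏-nonNeg (allFin n) (λ w → *-nonNeg h⁻¹-nonNeg (weight-nonNeg (lookup φ w) (lookup U w))))

  𝔼-cong : ∀ {f g : RandomVariable} → (∀ φ U → f φ U ≡ g φ U) → 𝔼 f ≡ 𝔼 g
  𝔼-cong f≗g = ∑-cong Φs (λ φ → ∑-cong Us (λ U → cong (mass φ U *ℚ_) (f≗g φ U)))

  𝔼-mono-≤ : ∀ {f g : RandomVariable} → (∀ φ U → f φ U ≤ g φ U) → 𝔼 f ≤ 𝔼 g
  𝔼-mono-≤ f≤g = ∑-mono-≤ Φs (λ φ → ∑-mono-≤ Us (λ U → *-monoˡ-≤ (mass-nonNeg φ U) (f≤g φ U)))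

  𝔼-zero : 𝔼 (λ _ _ → 0ℚ) ≡ 0ℚ
  𝔼-zero = ∑-zero Φs (λ φ → ∑-zero Us (λ U → ℚ.*-zeroʳ (mass φ U)))

  𝔼-distrib-+ : ∀ (f g : RandomVariable) → 𝔼 (λ φ U → f φ U + g φ U) ≡ 𝔼 f + 𝔼 g
  𝔼-distrib-+ f g = trans
    (∑-cong Φs (λ φ → trans (∑-cong Us (λ U → ℚ.*-distribˡ-+ (mass φ U) (f φ U) (g φ U))) (∑-distrib-+ Us _ _)))
    (∑-distrib-+ Φs _ _)

  𝔼-*ˡ : ∀ c (f : RandomVariable) → 𝔼 (λ φ U → c *ℚ f φ U) ≡ c *ℚ 𝔼 f
  𝔼-*ˡ c f = sym (trans (*-distribˡ-∑ Φs c _) (∑-cong Φs (λ φ → trans (*-distribˡ-∑ Us c _)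
    (∑-cong Us (λ U → *-exchangeˡ c (mass φ U) (f φ U))))))

  𝔼-∑ : ∀ {A : Set} (L : List A) (f : A → RandomVariable) →
        𝔼 (λ φ U → ∑ L (λ a → f a φ U)) ≡ ∑ L (λ a → 𝔼 (f a))
  𝔼-∑ []      f = 𝔼-zero
  𝔼-∑ (a ∷ L) f = trans (𝔼-distrib-+ (f a) _) (cong (_+_ (𝔼 (f a))) (𝔼-∑ L f))

  𝔼-∏ : ∀ (G : Fin n → Fin h → Bool → ℚ) →
        𝔼 (λ φ U → ∏ (allFin n) (λ w → G w (lookup φ w) (lookup U w))) ≡ ∏ (allFin n) (λ w → 𝔼₁ (G w))
  𝔼-∏ G = begin
    𝔼 (λ φ U → ∏ (allFin n) (λ w → G w (lookup φ w) (lookup U w)))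
      ≡⟨ ∑-cong Φs (λ φ → ∑-cong Us (λ U → mass*∏ φ U)) ⟩
    ∑ Φs (λ φ → ∑ Us (λ U → ∏ (allFin n) (λ w → term w (lookup φ w) (lookup U w))))
      ≡⟨ ∑-cong Φs (λ φ → ∑-allVecs-∏ bools n (λ w → term w (lookup φ w))) ⟩
    ∑ Φs (λ φ → ∏ (allFin n) (λ w → ∑ bools (term w (lookup φ w))))
      ≡⟨ ∑-allVecs-∏ (allFin h) n (λ w a → ∑ bools (term w a)) ⟩
    ∏ (allFin n) (λ w → 𝔼₁ (G w)) ∎
    where
    open ≡-Reasoning
    term : Fin n → Fin h → Bool → ℚ
    term w a b = h⁻¹ *ℚ (weight a b *ℚ G w a b)
    mass*∏ : ∀ φ U → mass φ U *ℚ ∏ (allFin n) (λ w → G w (lookup φ w) (lookup U w))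
                   ≡ ∏ (allFin n) (λ w → term w (lookup φ w) (lookup U w))
    mass*∏ φ U = begin
      mass φ U *ℚ ∏ (allFin n) (λ w → G w (lookup φ w) (lookup U w))
        ≡⟨ cong (_*ℚ ∏ (allFin n) (λ w → G w (lookup φ w) (lookup U w))) (mass≡∏ φ U) ⟩
      ∏ (allFin n) (λ w → h⁻¹ *ℚ weight (lookup φ w) (lookup U w)) *ℚ ∏ (allFin n) (λ w → G w (lookup φ w) (lookup U w))
        ≡⟨ sym (∏-distrib-* (allFin n) _ _) ⟩
      ∏ (allFin n) (λ w → (h⁻¹ *ℚ weight (lookup φ w) (lookup U w)) *ℚ G w (lookup φ w) (lookup U w))
        ≡⟨ ∏-cong (allFin n) (λ w → ℚ.*-assoc h⁻¹ _ _) ⟩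
      ∏ (allFin n) (λ w → term w (lookup φ w) (lookup U w)) ∎

  second-moment : ∀ {P : Colouring n h → Vec Bool n → Set} (P? : ∀ φ U → Dec (P φ U)) (Y : RandomVariable) →
                  (∀ φ U → ¬ P φ U → Y φ U ≡ 0ℚ) → ∀ t →
                  t *ℚ 𝔼 Y + t *ℚ 𝔼 Y ≤ (t *ℚ t) *ℚ 𝔼 (λ φ U → 𝟙 (P? φ U)) + 𝔼 (λ φ U → Y φ U *ℚ Y φ U)
  second-moment P? Y Y≡0 t = begin
    t *ℚ 𝔼 Y + t *ℚ 𝔼 Y
      ≡⟨ sym (trans (𝔼-distrib-+ _ _) (cong₂ _+_ (𝔼-*ˡ t Y) (𝔼-*ˡ t Y))) ⟩
    𝔼 (λ φ U → t *ℚ Y φ U + t *ℚ Y φ U)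
      ≤⟨ 𝔼-mono-≤ (λ φ U → pointwise (P? φ U) (Y≡0 φ U)) ⟩
    𝔼 (λ φ U → (t *ℚ t) *ℚ 𝟙 (P? φ U) + Y φ U *ℚ Y φ U)
      ≡⟨ trans (𝔼-distrib-+ _ _) (cong (_+ 𝔼 (λ φ U → Y φ U *ℚ Y φ U)) (𝔼-*ˡ (t *ℚ t) _)) ⟩
    (t *ℚ t) *ℚ 𝔼 (λ φ U → 𝟙 (P? φ U)) + 𝔼 (λ φ U → Y φ U *ℚ Y φ U) ∎
    where
    open ℚ.≤-Reasoning
    pointwise : ∀ {Q : Set} {y} (Q? : Dec Q) → (¬ Q → y ≡ 0ℚ) → t *ℚ y + t *ℚ y ≤ (t *ℚ t) *ℚ 𝟙 Q? + y *ℚ y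
    pointwise {y = y} (yes _) _ =
      subst (λ z → t *ℚ y + t *ℚ y ≤ z + y *ℚ y) (sym (ℚ.*-identityʳ (t *ℚ t))) (2ty≤t²+y² t y)
    pointwise {y = y} (no ¬q) y≡0 rewrite y≡0 ¬q =
      ℚ.≤-reflexive (solve 1 (λ t → t :* con 0ℚ :+ t :* con 0ℚ := (t :* t) :* con 0ℚ :+ con 0ℚ :* con 0ℚ) refl t)
      where open +-*-Solver

  record LocalEvent : Set₁ where
    field
      Allowed  : Fin n → Fin h → Bool → Set
      allowed? : ∀ w a b → Dec (Allowed w a b)

  open LocalEvent

  Holds : LocalEvent → Colouring n h → Vec Bool n → Set
  Holds L φ U = ∀ w → Allowed L w (lookup φ w) (lookup U w)

  holds? : ∀ L φ U → Dec (Holds L φ U)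
  holds? L φ U = all? (λ w → allowed? L w (lookup φ w) (lookup U w))

  𝟙[_] : LocalEvent → RandomVariable
  𝟙[ L ] φ U = 𝟙 (holds? L φ U)

  prob : LocalEvent → ℚ
  prob L = 𝔼 𝟙[ L ]

  localProb : LocalEvent → Fin n → ℚ
  localProb L w = 𝔼₁ (λ a b → 𝟙 (allowed? L w a b))

  prob≡∏ : ∀ L → prob L ≡ ∏ (allFin n) (localProb L)
  prob≡∏ L = trans (𝔼-cong (λ φ U → sym (𝟙-∏ (λ w → allowed? L w (lookup φ w) (lookup U w)))))
                   (𝔼-∏ (λ w a b → 𝟙 (allowed? L w a b)))

  Unconstrained : LocalEvent → Fin n → Set
  Unconstrained L w = ∀ a b → Allowed L w a b

  localProb-unconstrained : ∀ L {w} → Unconstrained L w → localProb L w ≡ 1ℚ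
  localProb-unconstrained L {w} free = trans (𝔼₁-cong (λ a b → 𝟙-yes (allowed? L w a b) (free a b))) 𝔼₁-one

  localProb-impossible : ∀ L {w} → (∀ a b → ¬ Allowed L w a b) → localProb L w ≡ 0ℚ
  localProb-impossible L {w} none = 𝔼₁-zero (λ a b → 𝟙-no (allowed? L w a b) (none a b))

  _∩_ : LocalEvent → LocalEvent → LocalEvent
  Allowed  (L ∩ M) w a b = Allowed L w a b × Allowed M w a b
  allowed? (L ∩ M) w a b = allowed? L w a b ×-dec allowed? M w a b

  𝟙[∩] : ∀ L M φ U → 𝟙[ L ∩ M ] φ U ≡ 𝟙[ L ] φ U *ℚ 𝟙[ M ] φ U
  𝟙[∩] L M φ U = begin
    𝟙[ L ∩ M ] φ U
      ≡⟨ sym (𝟙-∏ (at (L ∩ M))) ⟩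
    ∏ (allFin n) (𝟙 ∘ at (L ∩ M))
      ≡⟨ ∏-cong (allFin n) (λ w → 𝟙-× (at L w) (at M w)) ⟩
    ∏ (allFin n) (λ w → 𝟙 (at L w) *ℚ 𝟙 (at M w))
      ≡⟨ ∏-distrib-* (allFin n) _ _ ⟩
    ∏ (allFin n) (𝟙 ∘ at L) *ℚ ∏ (allFin n) (𝟙 ∘ at M)
      ≡⟨ cong₂ _*ℚ_ (𝟙-∏ (at L)) (𝟙-∏ (at M)) ⟩
    𝟙[ L ] φ U *ℚ 𝟙[ M ] φ U ∎
    where
    open ≡-Reasoning
    at : ∀ K w → Dec (Allowed K w (lookup φ w) (lookup U w))
    at K w = allowed? K w (lookup φ w) (lookup U w)

  prob-∩-disjoint : ∀ L M → (∀ w → Unconstrained L w ⊎ Unconstrained M w) → prob (L ∩ M) ≡ prob L *ℚ prob M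
  prob-∩-disjoint L M disjoint = begin
    prob (L ∩ M)                                               ≡⟨ prob≡∏ (L ∩ M) ⟩
    ∏ (allFin n) (localProb (L ∩ M))                           ≡⟨ ∏-cong (allFin n) (λ w → local w (disjoint w)) ⟩
    ∏ (allFin n) (λ w → localProb L w *ℚ localProb M w)        ≡⟨ ∏-distrib-* (allFin n) _ _ ⟩
    ∏ (allFin n) (localProb L) *ℚ ∏ (allFin n) (localProb M)   ≡⟨ sym (cong₂ _*ℚ_ (prob≡∏ L) (prob≡∏ M)) ⟩
    prob L *ℚ prob M                                           ∎
    where
    open ≡-Reasoning
    local : ∀ w → Unconstrained L w ⊎ Unconstrained M w → localProb (L ∩ M) w ≡ localProb L w *ℚ localProb M w
    local w (inj₁ free) = begin
      localProb (L ∩ M) w              ≡⟨ 𝔼₁-cong (λ a b → 𝟙-×-yesˡ (allowed? L w a b) (allowed? M w a b) (free a b)) ⟩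
      localProb M w                    ≡⟨ sym (ℚ.*-identityˡ (localProb M w)) ⟩
      1ℚ *ℚ localProb M w              ≡⟨ cong (_*ℚ localProb M w) (sym (localProb-unconstrained L free)) ⟩
      localProb L w *ℚ localProb M w   ∎
    local w (inj₂ free) = begin
      localProb (L ∩ M) w              ≡⟨ 𝔼₁-cong (λ a b → 𝟙-×-yesʳ (allowed? L w a b) (allowed? M w a b) (free a b)) ⟩
      localProb L w                    ≡⟨ sym (ℚ.*-identityʳ (localProb L w)) ⟩
      localProb L w *ℚ 1ℚ              ≡⟨ cong (localProb L w *ℚ_) (sym (localProb-unconstrained M free)) ⟩
      localProb L w *ℚ localProb M w   ∎

  colour₁ : Fin h
  colour₁ = fromℕ< (ℕ.>-nonZero⁻¹ h)

  inU₁ : Fin n → LocalEvent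
  Allowed  (inU₁ u) w a b = w ≡ u → toℕ a ≡ 0 × b ≡ true
  allowed? (inU₁ u) w a b = (w ≟ᶠ u) →-dec ((toℕ a ℕ.≟ 0) ×-dec (b Bool.≟ true))

  prob-inU₁ : ∀ u → prob (inU₁ u) ≡ h⁻¹ *ℚ p
  prob-inU₁ u = begin
    prob (inU₁ u)
      ≡⟨ prob≡∏ (inU₁ u) ⟩
    ∏ (allFin n) (localProb (inU₁ u))
      ≡⟨ ∏-delta u _ (λ w w≢u → localProb-unconstrained (inU₁ u) (off-u w w≢u)) ⟩
    localProb (inU₁ u) u
      ≡⟨ 𝔼₁-point G colour₁ not-colour₁ (𝟙-yes (at colour₁ true) (λ _ → colour₁≡0 , refl))
                                        (𝟙-no (at colour₁ false) (λ at-u → false≢true (proj₂ (at-u refl)))) ⟩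
    h⁻¹ *ℚ (weight colour₁ true *ℚ 1ℚ + weight colour₁ false *ℚ 0ℚ)
      ≡⟨ cong (h⁻¹ *ℚ_) (weight-selected colour₁ colour₁≡0) ⟩
    h⁻¹ *ℚ p ∎
    where
    open ≡-Reasoning
    at : ∀ a b → Dec (Allowed (inU₁ u) u a b)
    at = allowed? (inU₁ u) u
    G : Fin h → Bool → ℚ
    G a b = 𝟙 (at a b)
    colour₁≡0 : toℕ colour₁ ≡ 0
    colour₁≡0 = toℕ-fromℕ< _
    off-u : ∀ w → w ≢ u → Unconstrained (inU₁ u) w
    off-u w w≢u a b w≡u = ⊥-elim (w≢u w≡u)
    not-colour₁ : ∀ a b → a ≢ colour₁ → G a b ≡ 0ℚ
    not-colour₁ a b a≢colour₁ = 𝟙-no (at a b)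
      (λ at-u → a≢colour₁ (toℕ-injective (trans (proj₁ (at-u refl)) (sym colour₁≡0))))

module CycleCount {n h : ℕ} .{{_ : NonZero h}} (E : Digraph n) (p : ℚ) (0≤p : 0ℚ ≤ p) (p≤1 : p ≤ 1ℚ) where

  open RandomColouring {n} {h} p 0≤p p≤1
  open LocalEvent

  A : ℚ
  A = h⁻ʰ *ℚ p

  K : ℚ
  K = (h⁻¹ *ℚ p) *ℚ A

  A-nonNeg : 0ℚ ≤ A
  A-nonNeg = *-nonNeg h⁻ʰ-nonNeg 0≤p

  K-nonNeg : 0ℚ ≤ K
  K-nonNeg = *-nonNeg (*-nonNeg h⁻¹-nonNeg 0≤p) A-nonNeg

  module Cycle {v : Fin n} (ω : OnCycle h (Edge E) v) where

    c : Vec (Fin n) h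
    c = proj₁ ω

    distinct : ∀ i j → lookup c i ≡ lookup c j → i ≡ j
    distinct = proj₁ (proj₁ (proj₂ ω))

    edges : ∀ j → Edge E (lookup c j) (lookup c (next j))
    edges = proj₂ (proj₁ (proj₂ ω))

    i₀ : Fin h
    i₀ = proj₁ (proj₂ (proj₂ ω))

    c[i₀]≡v : lookup c i₀ ≡ v
    c[i₀]≡v = proj₂ (proj₂ (proj₂ ω))

    event : LocalEvent
    Allowed  event w a b = (∀ j → lookup c j ≡ w → a ≡ shift i₀ j) × (w ≡ v → b ≡ true)
    allowed? event w a b =
      all? (λ j → (lookup c j ≟ᶠ w) →-dec (a ≟ᶠ shift i₀ j)) ×-dec ((w ≟ᶠ v) →-dec (b Bool.≟ true))

    event⇒FHasCycle : ∀ φ U → Holds event φ U → FHasCycle h E φ U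
    event⇒FHasCycle φ U holds = c , distinct , λ j → inF j , inF (next j) , edges j , step j
      where
      coloured : ∀ j → lookup φ (lookup c j) ≡ shift i₀ j
      coloured j = proj₁ (holds (lookup c j)) j refl
      selected : ∀ j → toℕ (shift i₀ j) ≡ 0 → T (lookup U (lookup c j))
      selected j shift≡0 = subst T (sym (proj₂ (holds (lookup c j)) c[j]≡v)) _
        where
        c[j]≡v : lookup c j ≡ v
        c[j]≡v = trans (cong (lookup c) (shift≡0⇒≡ i₀ j shift≡0)) c[i₀]≡v
      inF : ∀ j → InF φ U (lookup c j)
      inF j with toℕ (shift i₀ j) ℕ.≟ 0
      ... | yes shift≡0 = inj₂ (trans (cong toℕ (coloured j)) shift≡0 , selected j shift≡0)
      ... | no shift≢0  = inj₁ (λ φ≡0 → shift≢0 (trans (cong toℕ (sym (coloured j))) φ≡0))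
      step : ∀ j → lookup φ (lookup c (next j)) ≡ next (lookup φ (lookup c j))
      step j = trans (coloured (next j)) (trans (shift-next i₀ j) (cong next (sym (coloured j))))

    event⇒inU₁ : ∀ φ U → Holds event φ U → Holds (inU₁ v) φ U
    event⇒inU₁ φ U holds w w≡v =
      trans (cong toℕ (proj₁ (holds w) i₀ (trans c[i₀]≡v (sym w≡v)))) (toℕ-shift-self i₀) , proj₂ (holds w) w≡v

    off-cycle-unconstrained : ∀ w → (∀ j → lookup c j ≢ w) → Unconstrained event w
    off-cycle-unconstrained w w∉c a b =
      (λ j c[j]≡w → ⊥-elim (w∉c j c[j]≡w)) , (λ w≡v → ⊥-elim (w∉c i₀ (trans c[i₀]≡v (sym w≡v))))

    pᵢ₀ : Fin h → ℚ
    pᵢ₀ j = if does (j ≟ᶠ i₀) then p else 1ℚ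

    ∏-pᵢ₀ : ∏ (allFin h) pᵢ₀ ≡ p
    ∏-pᵢ₀ = trans (∏-delta i₀ pᵢ₀ off) at-i₀
      where
      at-i₀ : pᵢ₀ i₀ ≡ p
      at-i₀ with i₀ ≟ᶠ i₀
      ... | yes _     = refl
      ... | no i₀≢i₀ = ⊥-elim (i₀≢i₀ refl)
      off : ∀ j → j ≢ i₀ → pᵢ₀ j ≡ 1ℚ
      off j j≢i₀ with j ≟ᶠ i₀
      ... | yes j≡i₀ = ⊥-elim (j≢i₀ j≡i₀)
      ... | no _     = refl

    localProb-on-cycle : ∀ j → localProb event (lookup c j) ≡ h⁻¹ *ℚ pᵢ₀ j
    localProb-on-cycle j = at-c[j] (j ≟ᶠ i₀)
      where
      α : Fin h
      α = shift i₀ j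
      at : ∀ a b → Dec (Allowed event (lookup c j) a b)
      at = allowed? event (lookup c j)
      G : Fin h → Bool → ℚ
      G a b = 𝟙 (at a b)
      off-α : ∀ a b → a ≢ α → G a b ≡ 0ℚ
      off-α a b a≢α = 𝟙-no (at a b) (λ allowed → a≢α (proj₁ allowed j refl))
      coloured-α : ∀ j′ → lookup c j′ ≡ lookup c j → α ≡ shift i₀ j′
      coloured-α j′ c[j′]≡c[j] = cong (shift i₀) (sym (distinct j′ j c[j′]≡c[j]))
      at-c[j] : (j≟i₀ : Dec (j ≡ i₀)) → 𝔼₁ G ≡ h⁻¹ *ℚ (if does j≟i₀ then p else 1ℚ)
      at-c[j] (yes refl) = trans
        (𝔼₁-point G α off-α (𝟙-yes (at α true) (coloured-α , λ _ → refl))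
                            (𝟙-no (at α false) (λ allowed → false≢true (proj₂ allowed c[i₀]≡v))))
        (cong (h⁻¹ *ℚ_) (weight-selected α (toℕ-shift-self i₀)))
      at-c[j] (no j≢i₀) = trans
        (𝔼₁-point G α off-α (𝟙-yes (at α true) (coloured-α , λ _ → refl))
                            (𝟙-yes (at α false) (coloured-α , c[j]≢v)))
        (cong (h⁻¹ *ℚ_) (weight-total α))
        where
        c[j]≢v : lookup c j ≡ v → false ≡ true
        c[j]≢v c[j]≡v = ⊥-elim (j≢i₀ (distinct j i₀ (trans c[j]≡v (sym c[i₀]≡v))))

    prob-event : prob event ≡ A
    prob-event = begin
      prob event                                  ≡⟨ prob≡∏ event ⟩
      ∏ (allFin n) (localProb event)              ≡⟨ ∏-image (lookup c) (distinct _ _) _ off-cycle ⟩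
      ∏ (allFin h) (localProb event ∘ lookup c)   ≡⟨ ∏-cong (allFin h) localProb-on-cycle ⟩
      ∏ (allFin h) (λ j → h⁻¹ *ℚ pᵢ₀ j)           ≡⟨ ∏-distrib-* (allFin h) (λ _ → h⁻¹) pᵢ₀ ⟩
      h⁻ʰ *ℚ ∏ (allFin h) pᵢ₀                     ≡⟨ cong (h⁻ʰ *ℚ_) ∏-pᵢ₀ ⟩
      h⁻ʰ *ℚ p                                    ∎
      where
      open ≡-Reasoning
      off-cycle : ∀ w → (∀ j → lookup c j ≢ w) → localProb event w ≡ 1ℚ
      off-cycle w w∉c = localProb-unconstrained event (off-cycle-unconstrained w w∉c)

    prob-inU₁∩event : ∀ {u} → u ≢ v → prob (inU₁ u ∩ event) ≤ K
    prob-inU₁∩event {u} u≢v with any? (λ j → lookup c j ≟ᶠ u)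
    ... | yes (j , c[j]≡u) = subst (_≤ K) (sym prob≡0) K-nonNeg
      where
      clash : ∀ a b → ¬ Allowed (inU₁ u ∩ event) u a b
      clash a b (selected , coloured) = u≢v (trans (sym c[j]≡u) (trans (cong (lookup c) j≡i₀) c[i₀]≡v))
        where
        j≡i₀ : j ≡ i₀
        j≡i₀ = shift≡0⇒≡ i₀ j (trans (cong toℕ (sym (proj₁ coloured j c[j]≡u))) (proj₁ (selected refl)))
      prob≡0 : prob (inU₁ u ∩ event) ≡ 0ℚ
      prob≡0 = trans (prob≡∏ (inU₁ u ∩ event)) (∏-zero u _ (localProb-impossible (inU₁ u ∩ event) clash))
    ... | no u∉c = ℚ.≤-reflexive (begin
      prob (inU₁ u ∩ event)         ≡⟨ prob-∩-disjoint (inU₁ u) event disjoint ⟩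
      prob (inU₁ u) *ℚ prob event   ≡⟨ cong₂ _*ℚ_ (prob-inU₁ u) prob-event ⟩
      K                             ∎)
      where
      open ≡-Reasoning
      disjoint : ∀ w → Unconstrained (inU₁ u) w ⊎ Unconstrained event w
      disjoint w with w ≟ᶠ u
      ... | yes refl = inj₂ (off-cycle-unconstrained w (λ j c[j]≡w → u∉c (j , c[j]≡w)))
      ... | no w≢u   = inj₁ (λ a b w≡u → ⊥-elim (w≢u w≡u))

  𝔼-event*event : ∀ {u v} (ωᵤ : OnCycle h (Edge E) u) (ωᵥ : OnCycle h (Edge E) v) → u ≢ v →
                  𝔼 (λ φ U → 𝟙[ Cycle.event ωᵤ ] φ U *ℚ 𝟙[ Cycle.event ωᵥ ] φ U) ≤ K
  𝔼-event*event {u} ωᵤ ωᵥ u≢v = begin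
    𝔼 (λ φ U → 𝟙[ Cycle.event ωᵤ ] φ U *ℚ 𝟙[ Cycle.event ωᵥ ] φ U)
      ≤⟨ 𝔼-mono-≤ (λ φ U → *-monoʳ-≤ (𝟙-nonNeg (holds? (Cycle.event ωᵥ) φ U))
                                    (𝟙-mono (holds? (Cycle.event ωᵤ) φ U) (holds? (inU₁ u) φ U)
                                            (Cycle.event⇒inU₁ ωᵤ φ U))) ⟩
    𝔼 (λ φ U → 𝟙[ inU₁ u ] φ U *ℚ 𝟙[ Cycle.event ωᵥ ] φ U)
      ≡⟨ 𝔼-cong (λ φ U → sym (𝟙[∩] (inU₁ u) (Cycle.event ωᵥ) φ U)) ⟩
    prob (inU₁ u ∩ Cycle.event ωᵥ)
      ≤⟨ Cycle.prob-inU₁∩event ωᵥ u≢v ⟩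
    K ∎
    where open ℚ.≤-Reasoning

  onCycle? : ∀ v → Dec (OnCycle h (Edge E) v)
  onCycle? = OnCycle? h (λ a b → T? (E a b))

  X : ℚ
  X = fromℕℚ (x h E)

  indicator : ∀ v → Dec (OnCycle h (Edge E) v) → RandomVariable
  indicator v (yes ω) = 𝟙[ Cycle.event ω ]
  indicator v (no _)  = λ _ _ → 0ℚ

  Y : RandomVariable
  Y φ U = ∑ (allFin n) (λ v → indicator v (onCycle? v) φ U)

  no-cycle⇒Y≡0 : ∀ φ U → ¬ FHasCycle h E φ U → Y φ U ≡ 0ℚ
  no-cycle⇒Y≡0 φ U no-cycle = ∑-zero (allFin n) (λ v → vanishes (onCycle? v))
    where
    vanishes : ∀ {v} (v-on-cycle? : Dec (OnCycle h (Edge E) v)) → indicator v v-on-cycle? φ U ≡ 0ℚ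
    vanishes (yes ω) = 𝟙-no (holds? (Cycle.event ω) φ U) (no-cycle ∘ Cycle.event⇒FHasCycle ω φ U)
    vanishes (no _)  = refl

  𝔼-indicator : ∀ v v-on-cycle? → 𝔼 (indicator v v-on-cycle?) ≡ 𝟙 v-on-cycle? *ℚ A
  𝔼-indicator v (yes ω) = trans (Cycle.prob-event ω) (sym (ℚ.*-identityˡ A))
  𝔼-indicator v (no _)  = trans 𝔼-zero (sym (ℚ.*-zeroˡ A))

  𝔼Y : 𝔼 Y ≡ X *ℚ A
  𝔼Y = begin
    𝔼 Y                                                  ≡⟨ 𝔼-∑ (allFin n) (λ v → indicator v (onCycle? v)) ⟩
    ∑ (allFin n) (λ v → 𝔼 (indicator v (onCycle? v)))    ≡⟨ ∑-cong (allFin n) (λ v → 𝔼-indicator v (onCycle? v)) ⟩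
    ∑ (allFin n) (λ v → 𝟙 (onCycle? v) *ℚ A)             ≡⟨ sym (*-distribʳ-∑ (allFin n) A (𝟙 ∘ onCycle?)) ⟩
    ∑ (allFin n) (𝟙 ∘ onCycle?) *ℚ A                     ≡⟨ cong (_*ℚ A) (∑-count onCycle? (allFin n)) ⟩
    X *ℚ A                                               ∎
    where open ≡-Reasoning

  𝔼-indicator*indicator : ∀ u v u-on-cycle? v-on-cycle? →
    𝔼 (λ φ U → indicator u u-on-cycle? φ U *ℚ indicator v v-on-cycle? φ U)
      ≤ 𝟙 u-on-cycle? *ℚ (𝟙 (u ≟ᶠ v) *ℚ A + 𝟙 v-on-cycle? *ℚ K)
  𝔼-indicator*indicator u v (no _) v-on-cycle? = ℚ.≤-reflexive (begin-equality
    𝔼 (λ φ U → 0ℚ *ℚ indicator v v-on-cycle? φ U)  ≡⟨ 𝔼-cong (λ φ U → ℚ.*-zeroˡ (indicator v v-on-cycle? φ U)) ⟩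
    𝔼 (λ _ _ → 0ℚ)                                 ≡⟨ 𝔼-zero ⟩
    0ℚ                                             ≡⟨ sym (ℚ.*-zeroˡ (𝟙 (u ≟ᶠ v) *ℚ A + 𝟙 v-on-cycle? *ℚ K)) ⟩
    0ℚ *ℚ (𝟙 (u ≟ᶠ v) *ℚ A + 𝟙 v-on-cycle? *ℚ K)   ∎)
    where open ℚ.≤-Reasoning
  𝔼-indicator*indicator u v (yes ωᵤ) (no _) = begin
    𝔼 (λ φ U → 𝟙[ Cycle.event ωᵤ ] φ U *ℚ 0ℚ)     ≡⟨ 𝔼-cong (λ φ U → ℚ.*-zeroʳ (𝟙[ Cycle.event ωᵤ ] φ U)) ⟩
    𝔼 (λ _ _ → 0ℚ)                                ≡⟨ 𝔼-zero ⟩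
    0ℚ                                            ≤⟨ *-nonNeg (ℚ.nonNegative⁻¹ 1ℚ) RHS-nonNeg ⟩
    1ℚ *ℚ (𝟙 (u ≟ᶠ v) *ℚ A + 0ℚ *ℚ K)             ∎
    where
    open ℚ.≤-Reasoning
    RHS-nonNeg : 0ℚ ≤ 𝟙 (u ≟ᶠ v) *ℚ A + 0ℚ *ℚ K
    RHS-nonNeg = +-nonNeg (*-nonNeg (𝟙-nonNeg (u ≟ᶠ v)) A-nonNeg) (ℚ.≤-reflexive (sym (ℚ.*-zeroˡ K)))
  𝔼-indicator*indicator u v (yes ωᵤ) (yes ωᵥ) with u ≟ᶠ v
  ... | yes refl = begin
    𝔼 (λ φ U → 𝟙[ Cycle.event ωᵤ ] φ U *ℚ 𝟙[ Cycle.event ωᵥ ] φ U)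
      ≤⟨ 𝔼-mono-≤ (λ φ U → ℚ.≤-trans (*-monoˡ-≤ (𝟙-nonNeg (holds? (Cycle.event ωᵤ) φ U))
                                                 (𝟙-≤1 (holds? (Cycle.event ωᵥ) φ U)))
                                     (ℚ.≤-reflexive (ℚ.*-identityʳ _))) ⟩
    prob (Cycle.event ωᵤ)        ≡⟨ Cycle.prob-event ωᵤ ⟩
    A                            ≤⟨ ≤-+-nonNeg K-nonNeg ⟩
    A + K                        ≡⟨ sym (trans (ℚ.*-identityˡ _) (cong₂ _+_ (ℚ.*-identityˡ A) (ℚ.*-identityˡ K))) ⟩
    1ℚ *ℚ (1ℚ *ℚ A + 1ℚ *ℚ K)    ∎
    where open ℚ.≤-Reasoning
  ... | no u≢v = begin
    𝔼 (λ φ U → 𝟙[ Cycle.event ωᵤ ] φ U *ℚ 𝟙[ Cycle.event ωᵥ ] φ U)   ≤⟨ 𝔼-event*event ωᵤ ωᵥ u≢v ⟩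
    K                            ≡⟨ sym (trans (ℚ.*-identityˡ _) (trans (cong₂ _+_ (ℚ.*-zeroˡ A) (ℚ.*-identityˡ K))
                                                                        (ℚ.+-identityˡ K))) ⟩
    1ℚ *ℚ (0ℚ *ℚ A + 1ℚ *ℚ K)    ∎
    where open ℚ.≤-Reasoning

  𝔼Y² : 𝔼 (λ φ U → Y φ U *ℚ Y φ U) ≤ X *ℚ (A + X *ℚ K)
  𝔼Y² = begin
    𝔼 (λ φ U → Y φ U *ℚ Y φ U)
      ≡⟨ 𝔼-cong Y*Y≡∑∑ ⟩
    𝔼 (λ φ U → ∑ (allFin n) (λ u → ∑ (allFin n) (λ v → I u φ U *ℚ I v φ U)))
      ≡⟨ trans (𝔼-∑ (allFin n) _) (∑-cong (allFin n) (λ u → 𝔼-∑ (allFin n) _)) ⟩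
    ∑ (allFin n) (λ u → ∑ (allFin n) (λ v → 𝔼 (λ φ U → I u φ U *ℚ I v φ U)))
      ≤⟨ ∑-mono-≤ (allFin n) (λ u → ∑-mono-≤ (allFin n) (λ v →
           𝔼-indicator*indicator u v (onCycle? u) (onCycle? v))) ⟩
    ∑ (allFin n) (λ u → ∑ (allFin n) (λ v → 𝟙 (onCycle? u) *ℚ (𝟙 (u ≟ᶠ v) *ℚ A + 𝟙 (onCycle? v) *ℚ K)))
      ≡⟨ ∑-cong (allFin n) row ⟩
    ∑ (allFin n) (λ u → 𝟙 (onCycle? u) *ℚ (A + X *ℚ K))
      ≡⟨ sym (*-distribʳ-∑ (allFin n) _ (𝟙 ∘ onCycle?)) ⟩
    ∑ (allFin n) (𝟙 ∘ onCycle?) *ℚ (A + X *ℚ K)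
      ≡⟨ cong (_*ℚ (A + X *ℚ K)) (∑-count onCycle? (allFin n)) ⟩
    X *ℚ (A + X *ℚ K) ∎
    where
    open ℚ.≤-Reasoning
    I : Fin n → RandomVariable
    I v = indicator v (onCycle? v)
    Y*Y≡∑∑ : ∀ φ U → Y φ U *ℚ Y φ U ≡ ∑ (allFin n) (λ u → ∑ (allFin n) (λ v → I u φ U *ℚ I v φ U))
    Y*Y≡∑∑ φ U = trans (*-distribʳ-∑ (allFin n) (Y φ U) (λ u → I u φ U))
                       (∑-cong (allFin n) (λ u → *-distribˡ-∑ (allFin n) (I u φ U) (λ v → I v φ U)))
    ∑-δ : ∀ u → ∑ (allFin n) (λ v → 𝟙 (u ≟ᶠ v) *ℚ A) ≡ A
    ∑-δ u = trans (∑-delta u _ (λ v v≢u → trans (cong (_*ℚ A) (𝟙-no (u ≟ᶠ v) (v≢u ∘ sym))) (ℚ.*-zeroˡ A)))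
                  (trans (cong (_*ℚ A) (𝟙-yes (u ≟ᶠ u) refl)) (ℚ.*-identityˡ A))
    ∑-𝟙K : ∑ (allFin n) (λ v → 𝟙 (onCycle? v) *ℚ K) ≡ X *ℚ K
    ∑-𝟙K = trans (sym (*-distribʳ-∑ (allFin n) K (𝟙 ∘ onCycle?))) (cong (_*ℚ K) (∑-count onCycle? (allFin n)))
    row : ∀ u → ∑ (allFin n) (λ v → 𝟙 (onCycle? u) *ℚ (𝟙 (u ≟ᶠ v) *ℚ A + 𝟙 (onCycle? v) *ℚ K))
              ≡ 𝟙 (onCycle? u) *ℚ (A + X *ℚ K)
    row u = trans (sym (*-distribˡ-∑ (allFin n) (𝟙 (onCycle? u)) _))
                  (cong (𝟙 (onCycle? u) *ℚ_) (trans (∑-distrib-+ (allFin n) _ _) (cong₂ _+_ (∑-δ u) ∑-𝟙K)))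

  cycle-second-moment : ∀ t → t *ℚ (X *ℚ A) + t *ℚ (X *ℚ A) ≤
                              (t *ℚ t) *ℚ Pr n h p (FHasCycle h E) (FHasCycle? h E) + X *ℚ (A + X *ℚ K)
  cycle-second-moment t = begin
    t *ℚ (X *ℚ A) + t *ℚ (X *ℚ A)           ≡⟨ cong (λ y → t *ℚ y + t *ℚ y) (sym 𝔼Y) ⟩
    t *ℚ 𝔼 Y + t *ℚ 𝔼 Y                     ≤⟨ second-moment (FHasCycle? h E) Y no-cycle⇒Y≡0 t ⟩
    (t *ℚ t) *ℚ 𝔼 (λ φ U → 𝟙 (FHasCycle? h E φ U)) + 𝔼 (λ φ U → Y φ U *ℚ Y φ U)
      ≡⟨ cong (λ P → (t *ℚ t) *ℚ P + 𝔼 (λ φ U → Y φ U *ℚ Y φ U)) (sym (Pr≡𝔼𝟙 (FHasCycle? h E))) ⟩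
    (t *ℚ t) *ℚ Pr n h p (FHasCycle h E) (FHasCycle? h E) + 𝔼 (λ φ U → Y φ U *ℚ Y φ U)
      ≤⟨ ℚ.+-monoʳ-≤ ((t *ℚ t) *ℚ Pr n h p (FHasCycle h E) (FHasCycle? h E)) 𝔼Y² ⟩
    (t *ℚ t) *ℚ Pr n h p (FHasCycle h E) (FHasCycle? h E) + X *ℚ (A + X *ℚ K) ∎
    where open ℚ.≤-Reasoning

¼ : ℚ
¼ = (+ 1) / 4

-- With m = p X and t = m r the hypothesis reads 2tmc ≤ t²P + mc + tmc, i.e. t²P ≥ (t − 1)mc,
-- and (t − 1)mc − t²c/4 = S below is nonnegative because t ≥ 4 and r ≤ 1.
¼c≤P : ∀ {X p r c P} → 0ℚ ≤ X → 0ℚ ≤ p → r ≤ 1ℚ → 0ℚ ≤ c →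
       let t = p *ℚ X *ℚ r in
       fromℕℚ 4 ≤ t →
       t *ℚ (X *ℚ (c *ℚ p)) + t *ℚ (X *ℚ (c *ℚ p)) ≤ (t *ℚ t) *ℚ P + X *ℚ (c *ℚ p + X *ℚ ((r *ℚ p) *ℚ (c *ℚ p))) →
       ¼ *ℚ c ≤ P
¼c≤P {X} {p} {r} {c} {P} 0≤X 0≤p r≤1 0≤c 4≤t second-moment-bound =
  ℚ.*-cancelˡ-≤-pos (t *ℚ t) {{ℚ.pos*pos⇒pos t {{t-pos}} t {{t-pos}}}} (begin
    (t *ℚ t) *ℚ (¼ *ℚ c)        ≤⟨ ≤-+-nonNeg S-nonNeg ⟩
    (t *ℚ t) *ℚ (¼ *ℚ c) + S    ≤⟨ +-cancelʳ-≤ R (subst (_≤ (t *ℚ t) *ℚ P + R) (sym identity) second-moment-bound) ⟩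
    (t *ℚ t) *ℚ P               ∎)
  where
  open ℚ.≤-Reasoning
  open +-*-Solver
  t m R S : ℚ
  t = p *ℚ X *ℚ r
  m = p *ℚ X
  R = X *ℚ (c *ℚ p + X *ℚ ((r *ℚ p) *ℚ (c *ℚ p)))
  S = ((+ 3) / 4 *ℚ (t - fromℕℚ 4) + fromℕℚ 2) *ℚ (m *ℚ c) + ¼ *ℚ t *ℚ (1ℚ - r) *ℚ (m *ℚ c)
  t-pos : Positive t
  t-pos = positive (ℚ.<-≤-trans (ℚ.positive⁻¹ (fromℕℚ 4)) 4≤t)
  0≤t : 0ℚ ≤ t
  0≤t = ℚ.≤-trans (ℚ.nonNegative⁻¹ (fromℕℚ 4)) 4≤t
  0≤mc : 0ℚ ≤ m *ℚ c
  0≤mc = *-nonNeg (*-nonNeg 0≤p 0≤X) 0≤c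
  S-nonNeg : 0ℚ ≤ S
  S-nonNeg = +-nonNeg
    (*-nonNeg (+-nonNeg (*-nonNeg (ℚ.nonNegative⁻¹ ((+ 3) / 4)) (p≤q⇒0≤q-p 4≤t)) (ℚ.nonNegative⁻¹ (fromℕℚ 2))) 0≤mc)
    (*-nonNeg (*-nonNeg (*-nonNeg (ℚ.nonNegative⁻¹ ¼) 0≤t) (p≤q⇒0≤q-p r≤1)) 0≤mc)
  identity : (t *ℚ t) *ℚ (¼ *ℚ c) + S + R ≡ t *ℚ (X *ℚ (c *ℚ p)) + t *ℚ (X *ℚ (c *ℚ p))
  identity = solve 4 (λ X p r c →
    let t = p :* X :* r ; mc = p :* X :* c in
    (t :* t) :* (con ¼ :* c)
      :+ ((con ((+ 3) / 4) :* (t :- con (fromℕℚ 4)) :+ con (fromℕℚ 2)) :* mc :+ con ¼ :* t :* (con 1ℚ :- r) :* mc)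
      :+ X :* (c :* p :+ X :* ((r :* p) :* (c :* p)))
    := t :* (X :* (c :* p)) :+ t :* (X :* (c :* p))) refl X p r c

claim8 : (h n : ℕ) .{{_ : NonZero h}} (E : Digraph n) (p : ℚ) →
    0ℚ ≤ p → p ≤ 1ℚ →
    fromℕℚ (4 * h ^ h) ≤ p *ℚ fromℕℚ (x h E) →
    ((+ 1) / (4 * h ^ h)) {{m*n≢0 4 (h ^ h) {{_}} {{m^n≢0 h h}}}} ≤ Pr n h p (FHasCycle h E) (FHasCycle? h E)
claim8 h n E p 0≤p p≤1 4hʰ≤pX = begin
  ((+ 1) / (4 * h ^ h)) {{m*n≢0 4 (h ^ h) {{_}} {{m^n≢0 h h}}}}
    ≡⟨ trans (1/[m*n] 4 (h ^ h) {{_}} {{m^n≢0 h h}}) (cong (¼ *ℚ_) (1/[m^k] h h)) ⟩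
  ¼ *ℚ h⁻ʰ
    ≤⟨ ¼c≤P (fromℕℚ-nonNeg (x h E)) 0≤p (1/m≤1 h) h⁻ʰ-nonNeg (4mᵐ≤a⇒4≤a/m h 4hʰ≤pX) (cycle-second-moment t) ⟩
  Pr n h p (FHasCycle h E) (FHasCycle? h E) ∎
  where
  open ℚ.≤-Reasoning
  open RandomColouring {n} {h} p 0≤p p≤1
  open CycleCount E p 0≤p p≤1
  t : ℚ
  t = p *ℚ X *ℚ h⁻¹
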